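{- For every nonnegative integer $\ell$, every nonnegative integer $n$ and every complex number $x$, $${}_3F_2\left[\begin{matrix} 3x,\ 2-\ell-3x,\ -n\\ \tfrac32-\ell,\ -1-3n\end{matrix}\middle|\frac34\right]=\left[\begin{matrix} 3x-1,\ 3x-\frac12\\ 6x-1,\ -\frac12\end{matrix}\right]_\ell\sum_{i=0}^{\ell}\left(\frac{3x+i-1}{3x-1}\right)^2\left[\begin{matrix} -\ell,\ 6x-2\\ 1,\ 6x+\ell-1\end{matrix}\right]_i\left[\begin{matrix} \frac{2+i}{3}+x,\ \frac{4-i}{3}-x\\ \frac23,\ \frac43\end{matrix}\right]_n.$$
   Context: For a complex number $a$ and a nonnegative integer $m$, $(a)_m=a(a+1)\cdots(a+m-1)$ with $(a)_0=1$. The bracket notation means $\left[\begin{matrix} a_1,\dots,a_r\\ b_1,\dots,b_s\end{matrix}\right]_m=\frac{(a_1)_m\cdots(a_r)_m}{(b_1)_m\cdots(b_s)_m}$. For a nonnegative integer $n$, ${}_3F_2\left[\begin{matrix} a,\ b,\ -n\\ d,\ e\end{matrix}\middle|z\right]=\sum_{k=0}^{n}\frac{(a)_k(b)_k(-n)_k}{k!\,(d)_k(e)_k}z^k$. The identity is understood for values of $x$ for which no denominator vanishes. -}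

module Defs where

open import Level using (Level; _⊔_) renaming (suc to lsuc)
open import Data.Nat as ℕ using (ℕ; zero; suc)
open import Relation.Nullary using (¬_)
open import Algebra.Bundles using (CommutativeRing)

ℕ→R : ∀ {c ℓ} (R : CommutativeRing c ℓ) → ℕ → CommutativeRing.Carrier R
ℕ→R R zero    = CommutativeRing.0# R
ℕ→R R (suc n) = CommutativeRing._+_ R (CommutativeRing.1# R) (ℕ→R R n)

-- A field of characteristic zero (the complex numbers are one).
-- The inverse is total; its value at 0 is unconstrained and never used
-- in the statement except behind hypotheses that the denominator is nonzero
-- (or at constants that are nonzero by characteristic zero).
record CharZeroField (c ℓ : Level) : Set (lsuc (c ⊔ ℓ)) where
  field
    commutativeRing : CommutativeRing c ℓ
  open CommutativeRing commutativeRing public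
  field
    _⁻¹        : Carrier → Carrier
    ⁻¹-cong    : ∀ {a b} → a ≈ b → a ⁻¹ ≈ b ⁻¹
    ⁻¹-inverse : ∀ a → ¬ (a ≈ 0#) → a * (a ⁻¹) ≈ 1#
    charZero   : ∀ n → ¬ (ℕ→R commutativeRing (suc n) ≈ 0#)

module FieldOps {c ℓ} (F : CharZeroField c ℓ) where
  open CharZeroField F hiding (zero)

  [_] : ℕ → Carrier
  [ n ] = ℕ→R commutativeRing n

  infixl 7 _/_
  _/_ : Carrier → Carrier → Carrier
  a / b = a * (b ⁻¹)

  pow : Carrier → ℕ → Carrier
  pow a zero    = 1#
  pow a (suc m) = pow a m * a

  poch : Carrier → ℕ → Carrier
  poch a zero    = 1#
  poch a (suc m) = poch a m * (a + [ m ])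

  sumTo : ℕ → (ℕ → Carrier) → Carrier
  sumTo zero    f = f zero
  sumTo (suc n) f = sumTo n f + f (suc n)

  bracket : Carrier → Carrier → Carrier → Carrier → ℕ → Carrier
  bracket a₁ a₂ b₁ b₂ m = (poch a₁ m * poch a₂ m) / (poch b₁ m * poch b₂ m)

  3F2 : Carrier → Carrier → ℕ → Carrier → Carrier → Carrier → Carrier
  3F2 a b n d e z =
    sumTo n (λ k → (poch a k * poch b k * poch (- [ n ]) k * pow z k)
                   / (poch 1# k * poch d k * poch e k))

  lhs9 : ℕ → ℕ → Carrier → Carrier
  lhs9 l n x =
    3F2 ([ 3 ] * x) ([ 2 ] - [ l ] - [ 3 ] * x) n
        ([ 3 ] / [ 2 ] - [ l ]) (- 1# - [ 3 ] * [ n ]) ([ 3 ] / [ 4 ])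

  rhs9 : ℕ → ℕ → Carrier → Carrier
  rhs9 l n x =
    bracket ([ 3 ] * x - 1#) ([ 3 ] * x - 1# / [ 2 ]) ([ 6 ] * x - 1#) (- (1# / [ 2 ])) l
    * sumTo l (λ i →
        pow (([ 3 ] * x + [ i ] - 1#) / ([ 3 ] * x - 1#)) 2
        * bracket (- [ l ]) ([ 6 ] * x - [ 2 ]) 1# ([ 6 ] * x + [ l ] - 1#) i
        * bracket (([ 2 ] + [ i ]) / [ 3 ] + x) (([ 4 ] - [ i ]) / [ 3 ] - x)
                  ([ 2 ] / [ 3 ]) ([ 4 ] / [ 3 ]) n)

module Submission where

-- Write t = 3x - 1 and view both sides as functions F(l, t).  Both satisfy the
-- contiguous relation
--   (1 - 2l)(2t + l + 1) F(l + 1, t) = α F(l, t) + (t + 1)(2t + 1) F(l, t + 1),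
-- the left side summand by summand in k, the right side summand by summand in i
-- once the t + 1 part is reindexed.  As the coefficient of F(l + 1, t) is
-- nonzero, induction on l (for all t at once) reduces the identity to l = 0.
-- There the right side is ((t + 3)/3)_n ((3 - t)/3)_n / ((2/3)_n (4/3)_n), and
-- the left side satisfies the same first-order recurrence in n, which follows by
-- telescoping with a Zeilberger certificate.

open import Data.Maybe using (Maybe; nothing; just)
open import Data.Nat as ℕ using (ℕ; zero; suc; _≤_; _<_; z≤n; s≤s)
import Data.Nat.Properties as ℕP
open import Data.Integer as ℤ using (ℤ; +_; -[1+_])
import Data.Integer.Properties as ℤP
open import Data.Product using (_×_; _,_; proj₁; proj₂)
open import Data.Sum using (inj₁; inj₂)
open import Data.Empty using (⊥-elim)
open import Relation.Binary.PropositionalEquality as ≡ using (_≡_; _≢_)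
open import Relation.Nullary using (¬_; yes; no)
open import Algebra.Solver.Ring.AlmostCommutativeRing
  using (AlmostCommutativeRing; fromCommutativeRing; _-Raw-AlmostCommutative⟶_)
open import Defs

3+2j≢2l : ∀ j l → 3 ℕ.+ 2 ℕ.* j ≢ 2 ℕ.* l
3+2j≢2l j l eq = ℕP.even≢odd l (suc j) (≡.trans (≡.sym eq) (≡.cong suc (≡.sym (ℕP.*-suc 2 j))))

m≤n⇒m≢1+k+3n : ∀ {m n} k → m ≤ n → m ≢ suc k ℕ.+ 3 ℕ.* n
m≤n⇒m≢1+k+3n {m} {n} k m≤n = ℕP.<⇒≢ (s≤s (ℕP.≤-trans m≤n (ℕP.≤-trans (ℕP.m≤n*m n 3) (ℕP.m≤n+m _ k))))

2i≢1 : ∀ i → 2 ℕ.* i ≢ 1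
2i≢1 i eq = ℕP.even≢odd i 0 eq

-- The polynomial identities of the proof are written once, over an arbitrary
-- ring signature: instantiated at the field they give the statements, and at
-- the syntax of the ring solver they give the solver's input.
record RingSyntax {a} (A : Set a) : Set a where
  infixl 6 _+_ _-_
  infixl 7 _*_
  infix  8 -_
  field
    _+_ _*_ _-_ : A → A → A
    -_          : A → A
    ⟨_⟩         : ℕ → A

module Polynomials {a} {A : Set a} (S : RingSyntax A) where
  open RingSyntax S

  -- Both sides F(l, t) satisfy κ F(l + 1, t) = α F(l, t) + γ F(l, t + 1);
  -- L stands for l and t for 3x - 1.
  κ : A → A → A
  κ t L = (⟨ 1 ⟩ - ⟨ 2 ⟩ * L) * (⟨ 2 ⟩ * t + L + ⟨ 1 ⟩)

  γ : A → A
  γ t = (t + ⟨ 1 ⟩) * (⟨ 2 ⟩ * t + ⟨ 1 ⟩)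

  α : A → A → A
  α t L = κ t L - γ t

  -- Summand k = M + 1 of the left side: numerator and denominator factors
  -- beyond those shared by the three summands of the contiguous relation.
  lhs-n₀ lhs-n₁ lhs-n₂ : A → A → A → A
  lhs-n₀ t L M = (t + ⟨ 1 ⟩) * (((⟨ 1 ⟩ - L) - t) + M)
  lhs-n₁ t L M = (t + ⟨ 1 ⟩) * ((⟨ 1 ⟩ - (⟨ 1 ⟩ + L)) - t)
  lhs-n₂ t L M = (((t + ⟨ 1 ⟩) + ⟨ 1 ⟩) + M) * ((⟨ 1 ⟩ - L) - (t + ⟨ 1 ⟩))

  lhs-d₀ lhs-d₁ : A → A → A
  lhs-d₀ L M = (⟨ 3 ⟩ - ⟨ 2 ⟩ * L) + ⟨ 2 ⟩ * M
  lhs-d₁ L M = ⟨ 3 ⟩ - ⟨ 2 ⟩ * (⟨ 1 ⟩ + L)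

  -- The recurrence ρ₁ S(n + 1) = ρ₀ S(n) of the left side at l = 0 (N stands
  -- for n), with the telescoping certificate R(m) = certNum / certDen:
  -- ρ₁ T(n + 1, m) - ρ₀ T(n, m) = R(m) T(n, m) - R(m - 1) T(n, m - 1).
  ρ₀ : A → A → A
  ρ₀ t N = ((t + ⟨ 3 ⟩) + ⟨ 3 ⟩ * N) * ((⟨ 3 ⟩ - t) + ⟨ 3 ⟩ * N)

  ρ₁ : A → A
  ρ₁ N = (⟨ 2 ⟩ + ⟨ 3 ⟩ * N) * (⟨ 4 ⟩ + ⟨ 3 ⟩ * N)

  certNum : A → A → A → A
  certNum t M N = (t * t - (⟨ 1 ⟩ + M) * (⟨ 1 ⟩ + M))
    * (⟨ 4 ⟩ * (⟨ 1 ⟩ + M) * (⟨ 1 ⟩ + M) - ⟨ 6 ⟩ * (⟨ 2 ⟩ * N + ⟨ 1 ⟩) * (⟨ 1 ⟩ + M) - (⟨ 6 ⟩ * N + ⟨ 4 ⟩))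

  certDen : A → A → A
  certDen M N = ⟨ 2 ⟩ * (⟨ 2 ⟩ * M + ⟨ 3 ⟩) * ((M - ⟨ 1 ⟩) - ⟨ 3 ⟩ * N)

  -- T(n, M + 1) / T(n, M) = termRatioNum / termRatioDen.
  termRatioNum : A → A → A → A
  termRatioNum t M N = ((t + ⟨ 1 ⟩) + M) * (((⟨ 1 ⟩ - ⟨ 0 ⟩) - t) + M) * (- N + M) * ⟨ 3 ⟩

  termRatioDen : A → A → A
  termRatioDen M N = ⟨ 2 ⟩ * (⟨ 1 ⟩ + M) * ((⟨ 3 ⟩ - ⟨ 2 ⟩ * ⟨ 0 ⟩) + ⟨ 2 ⟩ * M) * ((- ⟨ 1 ⟩ - ⟨ 3 ⟩ * N) + M)

  -- T(n + 1, M + 1) / T(n, M) = shiftNum / shiftDen; the factor gap clears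
  -- (-1 - 3 (n + 1))_(M + 1) against (-1 - 3 n)_M.
  bottom : A → A
  bottom N = - ⟨ 1 ⟩ - ⟨ 3 ⟩ * (⟨ 1 ⟩ + N)

  gap : A → A → A
  gap M N = (bottom N + (⟨ 1 ⟩ + M)) * (bottom N + (⟨ 1 ⟩ + (⟨ 1 ⟩ + M)))

  bottom³ : A → A
  bottom³ N = bottom N * (bottom N + ⟨ 1 ⟩) * ((bottom N + ⟨ 1 ⟩) + ⟨ 1 ⟩)

  shiftNum : A → A → A → A
  shiftNum t M N = ((t + ⟨ 1 ⟩) + M) * (((⟨ 1 ⟩ - ⟨ 0 ⟩) - t) + M) * (- (⟨ 1 ⟩ + N)) * ⟨ 3 ⟩ * gap M N

  shiftDen : A → A → A
  shiftDen M N = ⟨ 2 ⟩ * (⟨ 1 ⟩ + M) * ((⟨ 3 ⟩ - ⟨ 2 ⟩ * ⟨ 0 ⟩) + ⟨ 2 ⟩ * M) * bottom³ N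

  -- The denominator shared by the four fractions of a telescoping step.
  commonDen : A → A → A
  commonDen M N = termRatioDen M N * certDen (⟨ 1 ⟩ + M) N * bottom³ N

  -- Summand i = J + 1 of the right side, as for the left side; rhs-n₂ and
  -- rhs-d₂ carry an extra common factor clearing the shift t ↦ t + 1.
  rhs-y : A → A → A
  rhs-y t L = (⟨ 2 ⟩ * t + L + ⟨ 1 ⟩) + ⟨ 1 ⟩

  rhs-n₀ rhs-n₁ rhs-n₂ : A → A → A → A
  rhs-n₀ t L J = (- L + J) * (⟨ 2 ⟩ * t)
  rhs-n₁ t L J = (t + L) * ((⟨ 2 ⟩ * t + ⟨ 1 ⟩) + ⟨ 2 ⟩ * L) * (- (⟨ 1 ⟩ + L)) * (⟨ 2 ⟩ * t)
  rhs-n₂ t L J = ((t + L) * ((⟨ 2 ⟩ * t + ⟨ 1 ⟩) + ⟨ 2 ⟩ * L) * ((⟨ 2 ⟩ * t + ⟨ 1 ⟩) + J))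
                 * ((((⟨ 2 ⟩ * t + ⟨ 1 ⟩) + ⟨ 1 ⟩) * rhs-y t L) * t)

  rhs-d₀ rhs-d₁ rhs-d₂ : A → A → A → A
  rhs-d₀ t L J = (⟨ 1 ⟩ + J) * (⟨ 2 ⟩ * t + L + ⟨ 1 ⟩)
  rhs-d₁ t L J = ((⟨ 2 ⟩ * t + ⟨ 1 ⟩) + L) * (- ⟨ 1 ⟩ + ⟨ 2 ⟩ * L) * (⟨ 1 ⟩ + J)
                 * ((⟨ 2 ⟩ * t + (⟨ 1 ⟩ + L) + ⟨ 1 ⟩) + J)
  rhs-d₂ t L J = ((⟨ 2 ⟩ * t + ⟨ 1 ⟩) + L) * ((⟨ 2 ⟩ * t + ⟨ 1 ⟩) + (⟨ 1 ⟩ + L)) * ((t + ⟨ 1 ⟩) * (t + ⟨ 1 ⟩))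
                 * (rhs-y t L + J) * (⟨ 2 ⟩ * t + ⟨ 1 ⟩)

  -- Summand i = 0 of the right side.
  rhs-n₁⁰ rhs-d₁⁰ : A → A → A
  rhs-n₁⁰ t L = (t + L) * ((⟨ 2 ⟩ * t + ⟨ 1 ⟩) + ⟨ 2 ⟩ * L)
  rhs-d₁⁰ t L = ((⟨ 2 ⟩ * t + ⟨ 1 ⟩) + L) * (- ⟨ 1 ⟩ + ⟨ 2 ⟩ * L)

module Arithmetic {c ℓ} (F : CharZeroField c ℓ) where
  open CharZeroField F hiding (zero) public
  open FieldOps F public
  open import Algebra.Properties.Ring ring
    using (-‿involutive; -‿distribˡ-*; -‿distribʳ-*; -0#≈0#; -‿+-comm; +-cancelˡ; x∙y⁻¹≈ε⇒x≈y) public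
  open import Relation.Binary.Reasoning.Setoid setoid public

  [m+n]≈[m]+[n] : ∀ m n → [ m ℕ.+ n ] ≈ [ m ] + [ n ]
  [m+n]≈[m]+[n] zero    n = sym (+-identityˡ _)
  [m+n]≈[m]+[n] (suc m) n = trans (+-congˡ ([m+n]≈[m]+[n] m n)) (sym (+-assoc _ _ _))

  [m*n]≈[m]*[n] : ∀ m n → [ m ℕ.* n ] ≈ [ m ] * [ n ]
  [m*n]≈[m]*[n] zero    n = sym (zeroˡ _)
  [m*n]≈[m]*[n] (suc m) n = begin
    [ n ℕ.+ m ℕ.* n ]          ≈⟨ [m+n]≈[m]+[n] n (m ℕ.* n) ⟩
    [ n ] + [ m ℕ.* n ]        ≈⟨ +-cong (sym (*-identityˡ _)) ([m*n]≈[m]*[n] m n) ⟩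
    1# * [ n ] + [ m ] * [ n ] ≈⟨ distribʳ _ _ _ ⟨
    [ suc m ] * [ n ]          ∎

  -- Integer coefficients for the ring solver: 0 and 1 are sent to 0# and 1#,
  -- every other n to [ n ], so that solver equations use the numerals of Defs.
  numeral : ℕ → Carrier
  numeral zero          = 0#
  numeral (suc zero)    = 1#
  numeral (suc (suc n)) = [ suc (suc n) ]

  ℤ→F : ℤ → Carrier
  ℤ→F (+ n)    = numeral n
  ℤ→F -[1+ n ] = - numeral (suc n)

  numeral≈[n] : ∀ n → numeral n ≈ [ n ]
  numeral≈[n] zero          = refl
  numeral≈[n] (suc zero)    = sym (+-identityʳ 1#)
  numeral≈[n] (suc (suc n)) = refl

  ℤ→F-negsuc : ∀ n → ℤ→F -[1+ n ] ≈ - [ suc n ]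
  ℤ→F-negsuc n = -‿cong (numeral≈[n] (suc n))

  ℤ→F-⊖ : ∀ m n → ℤ→F (m ℤ.⊖ n) ≈ [ m ] - [ n ]
  ℤ→F-⊖ m       zero    = trans (numeral≈[n] m) (sym (trans (+-congˡ -0#≈0#) (+-identityʳ _)))
  ℤ→F-⊖ zero    (suc n) = trans (ℤ→F-negsuc n) (sym (+-identityˡ _))
  ℤ→F-⊖ (suc m) (suc n) rewrite ℤP.[1+m]⊖[1+n]≡m⊖n m n = trans (ℤ→F-⊖ m n) (begin
    [ m ] - [ n ]                 ≈⟨ +-identityˡ _ ⟨
    0# + ([ m ] - [ n ])          ≈⟨ +-congʳ (-‿inverseʳ 1#) ⟨
    (1# - 1#) + ([ m ] - [ n ])   ≈⟨ +-assoc _ _ _ ⟩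
    1# + (- 1# + ([ m ] - [ n ])) ≈⟨ +-congˡ (trans (sym (+-assoc _ _ _)) (trans (+-congʳ (+-comm _ _)) (+-assoc _ _ _))) ⟩
    1# + ([ m ] + (- 1# - [ n ])) ≈⟨ +-congˡ (+-congˡ (-‿+-comm 1# [ n ])) ⟩
    1# + ([ m ] - (1# + [ n ]))   ≈⟨ +-assoc _ _ _ ⟨
    (1# + [ m ]) - (1# + [ n ])   ∎)

  ℤ→F-homo-+ : ∀ i j → ℤ→F (i ℤ.+ j) ≈ ℤ→F i + ℤ→F j
  ℤ→F-homo-+ (+ m)    (+ n)    = trans (numeral≈[n] (m ℕ.+ n)) (trans ([m+n]≈[m]+[n] m n) (sym (+-cong (numeral≈[n] m) (numeral≈[n] n))))
  ℤ→F-homo-+ (+ m)    -[1+ n ] = trans (ℤ→F-⊖ m (suc n)) (sym (+-cong (numeral≈[n] m) (ℤ→F-negsuc n)))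
  ℤ→F-homo-+ -[1+ m ] (+ n)    = trans (ℤ→F-⊖ n (suc m)) (trans (+-comm _ _) (sym (+-cong (ℤ→F-negsuc m) (numeral≈[n] n))))
  ℤ→F-homo-+ -[1+ m ] -[1+ n ] = begin
    ℤ→F -[1+ suc (m ℕ.+ n) ]     ≈⟨ ℤ→F-negsuc (suc (m ℕ.+ n)) ⟩
    - [ suc (suc (m ℕ.+ n)) ]    ≈⟨ -‿cong (reflexive (≡.cong [_] (≡.cong suc (ℕP.+-suc m n)))) ⟨
    - [ suc m ℕ.+ suc n ]        ≈⟨ -‿cong ([m+n]≈[m]+[n] (suc m) (suc n)) ⟩
    - ([ suc m ] + [ suc n ])    ≈⟨ -‿+-comm _ _ ⟨
    - [ suc m ] + - [ suc n ]    ≈⟨ +-cong (ℤ→F-negsuc m) (ℤ→F-negsuc n) ⟨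
    ℤ→F -[1+ m ] + ℤ→F -[1+ n ]  ∎

  ℤ→F-neg-+ : ∀ k → ℤ→F (ℤ.- (+ k)) ≈ - [ k ]
  ℤ→F-neg-+ zero    = sym -0#≈0#
  ℤ→F-neg-+ (suc k) = ℤ→F-negsuc k

  ℤ→F-homo-* : ∀ i j → ℤ→F (i ℤ.* j) ≈ ℤ→F i * ℤ→F j
  ℤ→F-homo-* (+ m) (+ n) rewrite ℤP.+◃n≡+n (m ℕ.* n) =
    trans (numeral≈[n] (m ℕ.* n)) (trans ([m*n]≈[m]*[n] m n) (sym (*-cong (numeral≈[n] m) (numeral≈[n] n))))
  ℤ→F-homo-* (+ m) -[1+ n ] rewrite ℤP.-◃n≡-n (m ℕ.* suc n) =
    trans (ℤ→F-neg-+ (m ℕ.* suc n)) (trans (-‿cong ([m*n]≈[m]*[n] m (suc n)))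
      (trans (-‿distribʳ-* _ _) (sym (*-cong (numeral≈[n] m) (ℤ→F-negsuc n)))))
  ℤ→F-homo-* -[1+ m ] (+ n) rewrite ℤP.-◃n≡-n (suc m ℕ.* n) =
    trans (ℤ→F-neg-+ (suc m ℕ.* n)) (trans (-‿cong ([m*n]≈[m]*[n] (suc m) n))
      (trans (-‿distribˡ-* _ _) (sym (*-cong (ℤ→F-negsuc m) (numeral≈[n] n)))))
  ℤ→F-homo-* -[1+ m ] -[1+ n ] rewrite ℤP.+◃n≡+n (suc m ℕ.* suc n) =
    trans (numeral≈[n] (suc m ℕ.* suc n)) (trans ([m*n]≈[m]*[n] (suc m) (suc n))
      (trans (sym (-‿involutive _)) (trans (-‿cong (-‿distribˡ-* _ _))
      (trans (-‿distribʳ-* _ _) (sym (*-cong (ℤ→F-negsuc m) (ℤ→F-negsuc n)))))))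

  ℤ→F-homo-neg : ∀ i → ℤ→F (ℤ.- i) ≈ - ℤ→F i
  ℤ→F-homo-neg (+ zero)  = sym -0#≈0#
  ℤ→F-homo-neg (+ suc n) = refl
  ℤ→F-homo-neg -[1+ n ]  = sym (-‿involutive _)

  private
    almostCommutativeRing : AlmostCommutativeRing c ℓ
    almostCommutativeRing = fromCommutativeRing commutativeRing

    ℤ→F-morphism : ℤ.+-*-rawRing -Raw-AlmostCommutative⟶ almostCommutativeRing
    ℤ→F-morphism = record
      { ⟦_⟧ = ℤ→F ; +-homo = ℤ→F-homo-+ ; *-homo = ℤ→F-homo-* ; -‿homo = ℤ→F-homo-neg
      ; 0-homo = refl ; 1-homo = refl }

    ℤ→F-≟ : ∀ a b → Maybe (ℤ→F a ≈ ℤ→F b)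
    ℤ→F-≟ a b with a ℤ.≟ b
    ... | yes ≡.refl = just refl
    ... | no _       = nothing

  open import Algebra.Solver.Ring ℤ.+-*-rawRing almostCommutativeRing ℤ→F-morphism ℤ→F-≟ public
    using (solve; _:=_; _:+_; _:*_; _:-_; :-_; con; Polynomial)

  carrierSyntax : RingSyntax Carrier
  carrierSyntax = record { _+_ = _+_ ; _*_ = _*_ ; _-_ = _-_ ; -_ = -_ ; ⟨_⟩ = numeral }

  polySyntax : ∀ n → RingSyntax (Polynomial n)
  polySyntax n = record { _+_ = _:+_ ; _*_ = _:*_ ; _-_ = _:-_ ; -_ = :-_ ; ⟨_⟩ = λ k → con (+ k) }

module Fractions {c ℓ} (F : CharZeroField c ℓ) where
  open Arithmetic F public

  ≉0-resp-≈ : ∀ {a b} → a ≈ b → a ≉ 0# → b ≉ 0#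
  ≉0-resp-≈ a≈b a≉0 b≈0 = a≉0 (trans a≈b b≈0)

  /-cancelʳ : ∀ {a b} → b ≉ 0# → (a / b) * b ≈ a
  /-cancelʳ {a} {b} b≉0 = begin
    (a * b ⁻¹) * b ≈⟨ *-assoc _ _ _ ⟩
    a * (b ⁻¹ * b) ≈⟨ *-congˡ (trans (*-comm _ _) (⁻¹-inverse b b≉0)) ⟩
    a * 1#         ≈⟨ *-identityʳ a ⟩
    a              ∎

  *-/-cancelʳ : ∀ {a b} → b ≉ 0# → (a * b) / b ≈ a
  *-/-cancelʳ {a} {b} b≉0 = trans (*-assoc _ _ _) (trans (*-congˡ (⁻¹-inverse b b≉0)) (*-identityʳ a))

  *-cancelʳ : ∀ {a b k} → k ≉ 0# → a * k ≈ b * k → a ≈ b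
  *-cancelʳ {a} {b} {k} k≉0 ak≈bk = begin
    a             ≈⟨ *-/-cancelʳ k≉0 ⟨
    (a * k) / k   ≈⟨ *-congʳ ak≈bk ⟩
    (b * k) / k   ≈⟨ *-/-cancelʳ k≉0 ⟩
    b             ∎

  *-≉0 : ∀ {a b} → a ≉ 0# → b ≉ 0# → a * b ≉ 0#
  *-≉0 {a} {b} a≉0 b≉0 ab≈0 = b≉0 (*-cancelʳ a≉0 (trans (*-comm b a) (trans ab≈0 (sym (zeroˡ a)))))

  *-≉0⁻ˡ : ∀ {a b} → a * b ≉ 0# → a ≉ 0#
  *-≉0⁻ˡ {a} {b} ab≉0 a≈0 = ab≉0 (trans (*-congʳ a≈0) (zeroˡ b))

  *-≉0⁻ʳ : ∀ {a b} → a * b ≉ 0# → b ≉ 0#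
  *-≉0⁻ʳ {a} {b} ab≉0 b≈0 = ab≉0 (trans (*-congˡ b≈0) (zeroʳ a))

  1≉0 : 1# ≉ 0#
  1≉0 1≈0 = charZero 0 (trans (+-identityʳ 1#) 1≈0)

  []-injective : ∀ m n → [ m ] ≈ [ n ] → m ≡ n
  []-injective zero    zero    _   = ≡.refl
  []-injective zero    (suc n) eq  = ⊥-elim (charZero n (sym eq))
  []-injective (suc m) zero    eq  = ⊥-elim (charZero m eq)
  []-injective (suc m) (suc n) eq  = ≡.cong suc ([]-injective m n (+-cancelˡ 1# _ _ eq))

  [a+b*n]≈ : ∀ a b n → [ a ℕ.+ b ℕ.* n ] ≈ numeral a + numeral b * [ n ]
  [a+b*n]≈ a b n = trans ([m+n]≈[m]+[n] a (b ℕ.* n))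
    (+-cong (sym (numeral≈[n] a)) (trans ([m*n]≈[m]*[n] b n) (*-congʳ (sym (numeral≈[n] b)))))

  ≉0-via-ℕ : ∀ {x P Q} p q → [ p ] ≈ P → [ q ] ≈ Q → x ≈ P - Q → p ≢ q → x ≉ 0#
  ≉0-via-ℕ p q [p]≈P [q]≈Q x≈P-Q p≢q x≈0 =
    p≢q ([]-injective p q (trans [p]≈P (trans (x∙y⁻¹≈ε⇒x≈y _ _ (trans (sym x≈P-Q) x≈0)) (sym [q]≈Q))))

  /-congˡ : ∀ {a b y} → a ≈ b → a / y ≈ b / y
  /-congˡ = *-congʳ

  /-congʳ : ∀ {a y z} → y ≈ z → a / y ≈ a / z
  /-congʳ y≈z = *-congˡ (⁻¹-cong y≈z)

  *-/-assoc : ∀ k a y → k * (a / y) ≈ (k * a) / y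
  *-/-assoc k a y = sym (*-assoc _ _ _)

  /-+-distrib : ∀ a b y → a / y + b / y ≈ (a + b) / y
  /-+-distrib a b y = sym (distribʳ _ _ _)

  /-sub-distrib : ∀ a b y → a / y - b / y ≈ (a - b) / y
  /-sub-distrib a b y = trans (+-congˡ (-‿distribˡ-* _ _)) (sym (distribʳ _ _ _))

  0/y≈0 : ∀ y → 0# / y ≈ 0#
  0/y≈0 y = zeroˡ _

  x/x≈1 : ∀ {a} → a ≉ 0# → a / a ≈ 1#
  x/x≈1 {a} = ⁻¹-inverse a

  /-cross : ∀ {a b c d} → b ≉ 0# → d ≉ 0# → a * d ≈ c * b → a / b ≈ c / d
  /-cross {a} {b} {c} {d} b≉0 d≉0 ad≈cb = *-cancelʳ (*-≉0 b≉0 d≉0) (begin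
    (a / b) * (b * d) ≈⟨ *-assoc _ _ _ ⟨
    ((a / b) * b) * d ≈⟨ *-congʳ (/-cancelʳ b≉0) ⟩
    a * d             ≈⟨ ad≈cb ⟩
    c * b             ≈⟨ *-congʳ (/-cancelʳ d≉0) ⟨
    ((c / d) * d) * b ≈⟨ solve 3 (λ x b d → x :* d :* b := x :* (b :* d)) refl _ b d ⟩
    (c / d) * (b * d) ∎)

  /-scale : ∀ {a b e} → b ≉ 0# → e ≉ 0# → a / b ≈ (a * e) / (b * e)
  /-scale {a} {b} {e} b≉0 e≉0 = /-cross b≉0 (*-≉0 b≉0 e≉0)
    (solve 3 (λ a b e → a :* (b :* e) := a :* e :* b) refl a b e)

  /-*-/ : ∀ {a b c d} → b ≉ 0# → d ≉ 0# → (a / b) * (c / d) ≈ (a * c) / (b * d)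
  /-*-/ {a} {b} {c} {d} b≉0 d≉0 = *-cancelʳ (*-≉0 b≉0 d≉0) (begin
    ((a / b) * (c / d)) * (b * d) ≈⟨ solve 4 (λ x y b d → x :* y :* (b :* d) := x :* b :* (y :* d)) refl _ _ b d ⟩
    ((a / b) * b) * ((c / d) * d) ≈⟨ *-cong (/-cancelʳ b≉0) (/-cancelʳ d≉0) ⟩
    a * c                         ≈⟨ /-cancelʳ (*-≉0 b≉0 d≉0) ⟨
    ((a * c) / (b * d)) * (b * d) ∎)

  cross-multiply₃ : ∀ {Z Z′ n₀ n₁ n₂ d₀ d₁ d₂ κ α γ} →
    Z′ * d₀ ≉ 0# → Z′ * d₁ ≉ 0# → Z′ * d₂ ≉ 0# →
    κ * n₁ * (d₀ * d₂) ≈ α * n₀ * (d₁ * d₂) + γ * n₂ * (d₁ * d₀) →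
    κ * ((Z * n₁) / (Z′ * d₁)) ≈ α * ((Z * n₀) / (Z′ * d₀)) + γ * ((Z * n₂) / (Z′ * d₂))
  cross-multiply₃ {Z} {Z′} {n₀} {n₁} {n₂} {d₀} {d₁} {d₂} {κ} {α} {γ} ≉0₀ ≉0₁ ≉0₂ identity = begin
    κ * ((Z * n₁) / (Z′ * d₁))
      ≈⟨ *-congˡ (trans (/-scale ≉0₁ (*-≉0 (*-≉0⁻ʳ ≉0₀) (*-≉0⁻ʳ ≉0₂))) (/-congʳ Y₁)) ⟩
    κ * (((Z * n₁) * (d₀ * d₂)) / Y)
      ≈⟨ *-/-assoc _ _ _ ⟩
    (κ * ((Z * n₁) * (d₀ * d₂))) / Y
      ≈⟨ /-congˡ (trans (pull-Z κ Z n₁ _) (trans (*-congˡ identity) (distribˡ _ _ _))) ⟩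
    (Z * (α * n₀ * (d₁ * d₂)) + Z * (γ * n₂ * (d₁ * d₀))) / Y
      ≈⟨ /-+-distrib _ _ _ ⟨
    (Z * (α * n₀ * (d₁ * d₂))) / Y + (Z * (γ * n₂ * (d₁ * d₀))) / Y
      ≈⟨ +-cong (/-congˡ (pull-Z α Z n₀ _)) (/-congˡ (pull-Z γ Z n₂ _)) ⟨
    (α * ((Z * n₀) * (d₁ * d₂))) / Y + (γ * ((Z * n₂) * (d₁ * d₀))) / Y
      ≈⟨ +-cong (*-/-assoc _ _ _) (*-/-assoc _ _ _) ⟨
    α * (((Z * n₀) * (d₁ * d₂)) / Y) + γ * (((Z * n₂) * (d₁ * d₀)) / Y)
      ≈⟨ +-cong (*-congˡ (trans (/-congʳ (sym Y₀)) (sym (/-scale ≉0₀ (*-≉0 (*-≉0⁻ʳ ≉0₁) (*-≉0⁻ʳ ≉0₂))))))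
                (*-congˡ (trans (/-congʳ (sym Y₂)) (sym (/-scale ≉0₂ (*-≉0 (*-≉0⁻ʳ ≉0₁) (*-≉0⁻ʳ ≉0₀)))))) ⟩
    α * ((Z * n₀) / (Z′ * d₀)) + γ * ((Z * n₂) / (Z′ * d₂)) ∎
    where
    Y = Z′ * (d₀ * d₁ * d₂)
    Y₀ : (Z′ * d₀) * (d₁ * d₂) ≈ Y
    Y₀ = solve 4 (λ z a b c → (z :* a) :* (b :* c) := z :* (a :* b :* c)) refl Z′ d₀ d₁ d₂
    Y₁ : (Z′ * d₁) * (d₀ * d₂) ≈ Y
    Y₁ = solve 4 (λ z a b c → (z :* b) :* (a :* c) := z :* (a :* b :* c)) refl Z′ d₀ d₁ d₂
    Y₂ : (Z′ * d₂) * (d₁ * d₀) ≈ Y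
    Y₂ = solve 4 (λ z a b c → (z :* c) :* (b :* a) := z :* (a :* b :* c)) refl Z′ d₀ d₁ d₂
    pull-Z : ∀ k z n e → k * ((z * n) * e) ≈ z * (k * n * e)
    pull-Z = solve 4 (λ k z n e → k :* ((z :* n) :* e) := z :* (k :* n :* e)) refl

  /-common-denominator : ∀ {Z Z′ n d e D} → Z′ ≉ 0# → D ≉ 0# → d * e ≈ D →
    (Z * n) / (Z′ * d) ≈ (Z * (n * e)) / (Z′ * D)
  /-common-denominator {Z} {Z′} {n} {d} {e} {D} Z′≉0 D≉0 de≈D = begin
    (Z * n) / (Z′ * d)         ≈⟨ /-scale (*-≉0 Z′≉0 (*-≉0⁻ˡ de≉0)) (*-≉0⁻ʳ de≉0) ⟩
    ((Z * n) * e) / ((Z′ * d) * e) ≈⟨ *-cong (*-assoc _ _ _) (⁻¹-cong (trans (*-assoc _ _ _) (*-congˡ de≈D))) ⟩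
    (Z * (n * e)) / (Z′ * D)   ∎
    where
    de≉0 : d * e ≉ 0#
    de≉0 = ≉0-resp-≈ (sym de≈D) D≉0

  common-denominator₄ : ∀ {Z Z′ D n₁ n₂ n₃ n₄ d₁ d₂ d₃ d₄ e₁ e₂ e₃ e₄ κ₂ κ₃} → Z′ ≉ 0# → D ≉ 0# →
    d₁ * e₁ ≈ D → d₂ * e₂ ≈ D → d₃ * e₃ ≈ D → d₄ * e₄ ≈ D →
    n₁ * e₁ + (κ₂ * (n₂ * e₂) - κ₃ * (n₃ * e₃)) ≈ n₄ * e₄ →
    (Z * n₁) / (Z′ * d₁) + (κ₂ * ((Z * n₂) / (Z′ * d₂)) - κ₃ * ((Z * n₃) / (Z′ * d₃))) ≈ (Z * n₄) / (Z′ * d₄)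
  common-denominator₄ {Z} {Z′} {D} {n₁} {n₂} {n₃} {n₄} {e₁ = e₁} {e₂} {e₃} {e₄} {κ₂} {κ₃} Z′≉0 D≉0 E₁ E₂ E₃ E₄ identity = begin
    (Z * n₁) / (Z′ * _) + (κ₂ * ((Z * n₂) / (Z′ * _)) - κ₃ * ((Z * n₃) / (Z′ * _)))
      ≈⟨ +-cong (common E₁) (+-cong (*-congˡ (common E₂)) (-‿cong (*-congˡ (common E₃)))) ⟩
    A₁ / Y + (κ₂ * (A₂ / Y) - κ₃ * (A₃ / Y))
      ≈⟨ +-congˡ (+-cong (*-/-assoc _ _ _) (-‿cong (*-/-assoc _ _ _))) ⟩
    A₁ / Y + ((κ₂ * A₂) / Y - (κ₃ * A₃) / Y)
      ≈⟨ +-congˡ (/-sub-distrib _ _ _) ⟩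
    A₁ / Y + (κ₂ * A₂ - κ₃ * A₃) / Y
      ≈⟨ /-+-distrib _ _ _ ⟩
    (A₁ + (κ₂ * A₂ - κ₃ * A₃)) / Y
      ≈⟨ /-congˡ (trans (pull-Z Z _ _ _ κ₂ κ₃) (*-congˡ identity)) ⟩
    (Z * (n₄ * e₄)) / Y
      ≈⟨ common E₄ ⟨
    (Z * n₄) / (Z′ * _) ∎
    where
    Y = Z′ * D
    A₁ = Z * (n₁ * e₁)
    A₂ = Z * (n₂ * e₂)
    A₃ = Z * (n₃ * e₃)
    common : ∀ {n d e} → d * e ≈ D → (Z * n) / (Z′ * d) ≈ (Z * (n * e)) / (Z′ * D)
    common = /-common-denominator Z′≉0 D≉0
    pull-Z : ∀ z x y w k₂ k₃ → z * x + (k₂ * (z * y) - k₃ * (z * w)) ≈ z * (x + (k₂ * y - k₃ * w))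
    pull-Z = solve 6 (λ z x y w k₂ k₃ → z :* x :+ (k₂ :* (z :* y) :- k₃ :* (z :* w)) := z :* (x :+ (k₂ :* y :- k₃ :* w))) refl

  common-denominator₂≈0 : ∀ {Z Z′ D n₁ n₂ d₁ d₂ e₁ e₂ κ} → Z′ ≉ 0# → D ≉ 0# → d₁ * e₁ ≈ D → d₂ * e₂ ≈ D →
    n₁ * e₁ + κ * (n₂ * e₂) ≈ 0# → (Z * n₁) / (Z′ * d₁) + κ * ((Z * n₂) / (Z′ * d₂)) ≈ 0#
  common-denominator₂≈0 {Z} {Z′} {D} {n₁} {n₂} {e₁ = e₁} {e₂} {κ} Z′≉0 D≉0 E₁ E₂ identity = begin
    (Z * n₁) / (Z′ * _) + κ * ((Z * n₂) / (Z′ * _))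
      ≈⟨ +-cong (common E₁) (*-congˡ (common E₂)) ⟩
    (Z * (n₁ * e₁)) / Y + κ * ((Z * (n₂ * e₂)) / Y)
      ≈⟨ +-congˡ (*-/-assoc _ _ _) ⟩
    (Z * (n₁ * e₁)) / Y + (κ * (Z * (n₂ * e₂))) / Y
      ≈⟨ /-+-distrib _ _ _ ⟩
    (Z * (n₁ * e₁) + κ * (Z * (n₂ * e₂))) / Y
      ≈⟨ /-congˡ (trans (pull-Z Z _ _ κ) (trans (*-congˡ identity) (zeroʳ Z))) ⟩
    0# / Y
      ≈⟨ 0/y≈0 Y ⟩
    0# ∎
    where
    Y = Z′ * D
    common : ∀ {n d e} → d * e ≈ D → (Z * n) / (Z′ * d) ≈ (Z * (n * e)) / (Z′ * D)
    common = /-common-denominator Z′≉0 D≉0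
    pull-Z : ∀ z x y k → z * x + k * (z * y) ≈ z * (x + k * y)
    pull-Z = solve 4 (λ z x y k → z :* x :+ k :* (z :* y) := z :* (x :+ k :* y)) refl

module Sums {c ℓ} (F : CharZeroField c ℓ) where
  open Fractions F public

  sumTo-cong : ∀ n {f g : ℕ → Carrier} → (∀ k → k ≤ n → f k ≈ g k) → sumTo n f ≈ sumTo n g
  sumTo-cong zero    f≈g = f≈g 0 z≤n
  sumTo-cong (suc n) f≈g = +-cong (sumTo-cong n (λ k k≤n → f≈g k (ℕP.m≤n⇒m≤1+n k≤n))) (f≈g (suc n) ℕP.≤-refl)

  sumTo-+ : ∀ n (f g : ℕ → Carrier) → sumTo n (λ k → f k + g k) ≈ sumTo n f + sumTo n g
  sumTo-+ zero    f g = refl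
  sumTo-+ (suc n) f g = trans (+-congʳ (sumTo-+ n f g))
    (solve 4 (λ a b c d → (a :+ b) :+ (c :+ d) := (a :+ c) :+ (b :+ d)) refl _ _ _ _)

  sumTo-sub : ∀ n (f g : ℕ → Carrier) → sumTo n (λ k → f k - g k) ≈ sumTo n f - sumTo n g
  sumTo-sub zero    f g = refl
  sumTo-sub (suc n) f g = trans (+-congʳ (sumTo-sub n f g))
    (solve 4 (λ a b c d → (a :- b) :+ (c :- d) := (a :+ c) :- (b :+ d)) refl _ _ _ _)

  *-distribˡ-sumTo : ∀ n k (f : ℕ → Carrier) → k * sumTo n f ≈ sumTo n (λ i → k * f i)
  *-distribˡ-sumTo zero    k f = refl
  *-distribˡ-sumTo (suc n) k f = trans (distribˡ _ _ _) (+-congʳ (*-distribˡ-sumTo n k f))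

  sumTo-unfoldˡ : ∀ n (f : ℕ → Carrier) → sumTo (suc n) f ≈ f 0 + sumTo n (λ k → f (suc k))
  sumTo-unfoldˡ zero    f = refl
  sumTo-unfoldˡ (suc n) f = trans (+-congʳ (sumTo-unfoldˡ n f)) (+-assoc _ _ _)

  sumTo-relation : ∀ n {κ α γ} {f₀ f₁ f₂ : ℕ → Carrier} →
    (∀ k → k ≤ n → κ * f₁ k ≈ α * f₀ k + γ * f₂ k) →
    κ * sumTo n f₁ ≈ α * sumTo n f₀ + γ * sumTo n f₂
  sumTo-relation n {κ} {α} {γ} {f₀} {f₁} {f₂} termwise = begin
    κ * sumTo n f₁                                    ≈⟨ *-distribˡ-sumTo n _ _ ⟩
    sumTo n (λ k → κ * f₁ k)                          ≈⟨ sumTo-cong n termwise ⟩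
    sumTo n (λ k → α * f₀ k + γ * f₂ k)               ≈⟨ sumTo-+ n _ _ ⟩
    sumTo n (λ k → α * f₀ k) + sumTo n (λ k → γ * f₂ k) ≈⟨ +-cong (*-distribˡ-sumTo n _ _) (*-distribˡ-sumTo n _ _) ⟨
    α * sumTo n f₀ + γ * sumTo n f₂                   ∎

  relation-*ʳ : ∀ {κ α γ w₀ w₁ w₂} G → κ * w₁ ≈ α * w₀ + γ * w₂ → κ * (w₁ * G) ≈ α * (w₀ * G) + γ * (w₂ * G)
  relation-*ʳ {κ} {α} {γ} {w₀} {w₁} {w₂} G rel = begin
    κ * (w₁ * G)                  ≈⟨ *-assoc κ w₁ G ⟨
    κ * w₁ * G                    ≈⟨ *-congʳ rel ⟩
    (α * w₀ + γ * w₂) * G         ≈⟨ solve 5 (λ a w₀ g w₂ G → (a :* w₀ :+ g :* w₂) :* G := a :* (w₀ :* G) :+ g :* (w₂ :* G)) refl α w₀ γ w₂ G ⟩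
    α * (w₀ * G) + γ * (w₂ * G)   ∎

module RisingFactorials {c ℓ} (F : CharZeroField c ℓ) where
  open Sums F public

  pochStep : Carrier → Carrier → ℕ → Carrier
  pochStep s a zero    = 1#
  pochStep s a (suc m) = pochStep s a m * (a + s * [ m ])

  poch-cong : ∀ {a b} → a ≈ b → ∀ m → poch a m ≈ poch b m
  poch-cong a≈b zero    = refl
  poch-cong a≈b (suc m) = *-cong (poch-cong a≈b m) (+-congʳ a≈b)

  pochStep-cong : ∀ {s a b} → a ≈ b → ∀ m → pochStep s a m ≈ pochStep s b m
  pochStep-cong a≈b zero    = refl
  pochStep-cong a≈b (suc m) = *-cong (pochStep-cong a≈b m) (+-congʳ a≈b)

  pow-cong : ∀ {a b} → a ≈ b → ∀ m → pow a m ≈ pow b m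
  pow-cong a≈b zero    = refl
  pow-cong a≈b (suc m) = *-cong (pow-cong a≈b m) a≈b

  poch-unfoldˡ : ∀ a m → poch a (suc m) ≈ a * poch (a + 1#) m
  poch-unfoldˡ a zero    = solve 1 (λ a → con (+ 1) :* (a :+ con (+ 0)) := a :* con (+ 1)) refl a
  poch-unfoldˡ a (suc m) = trans (*-congʳ (poch-unfoldˡ a m))
    (solve 3 (λ a X M → (a :* X) :* (a :+ (con (+ 1) :+ M)) := a :* (X :* ((a :+ con (+ 1)) :+ M)))
           refl a (poch (a + 1#) m) [ m ])

  pochStep-unfoldˡ : ∀ s a m → pochStep s a (suc m) ≈ a * pochStep s (a + s) m
  pochStep-unfoldˡ s a zero    = solve 2 (λ s a → con (+ 1) :* (a :+ s :* con (+ 0)) := a :* con (+ 1)) refl s a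
  pochStep-unfoldˡ s a (suc m) = trans (*-congʳ (pochStep-unfoldˡ s a m))
    (solve 4 (λ s a X M → (a :* X) :* (a :+ s :* (con (+ 1) :+ M)) := a :* (X :* ((a :+ s) :+ s :* M)))
           refl s a (pochStep s (a + s) m) [ m ])

  poch-≉0 : ∀ a m → (∀ j → j < m → a + [ j ] ≉ 0#) → poch a m ≉ 0#
  poch-≉0 a zero    factors = 1≉0
  poch-≉0 a (suc m) factors =
    *-≉0 (poch-≉0 a m (λ j j<m → factors j (ℕP.m<n⇒m<1+n j<m))) (factors m ℕP.≤-refl)

  pochStep-≉0 : ∀ s a m → (∀ j → j < m → a + s * [ j ] ≉ 0#) → pochStep s a m ≉ 0#
  pochStep-≉0 s a zero    factors = 1≉0
  pochStep-≉0 s a (suc m) factors =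
    *-≉0 (pochStep-≉0 s a m (λ j j<m → factors j (ℕP.m<n⇒m<1+n j<m))) (factors m ℕP.≤-refl)

  poch-≉0⁻¹ : ∀ a m → poch a m ≉ 0# → ∀ j → j < m → a + [ j ] ≉ 0#
  poch-≉0⁻¹ a (suc m) ≉0 j j<1+m with ℕP.m≤n⇒m<n∨m≡n (ℕP.≤-pred j<1+m)
  ... | inj₁ j<m    = poch-≉0⁻¹ a m (*-≉0⁻ˡ ≉0) j j<m
  ... | inj₂ ≡.refl = *-≉0⁻ʳ ≉0

  pow-≉0 : ∀ a m → a ≉ 0# → pow a m ≉ 0#
  pow-≉0 a zero    a≉0 = 1≉0
  pow-≉0 a (suc m) a≉0 = *-≉0 (pow-≉0 a m a≉0) a≉0

  pow-*-distrib : ∀ a b k → pow a k * pow b k ≈ pow (a * b) k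
  pow-*-distrib a b zero    = *-identityʳ 1#
  pow-*-distrib a b (suc k) =
    trans (solve 4 (λ x a y b → (x :* a) :* (y :* b) := (x :* y) :* (a :* b)) refl _ _ _ _)
          (*-congʳ (pow-*-distrib a b k))

  poch-rescale : ∀ s a k → s ≉ 0# → poch (a / s) k * pow s k ≈ pochStep s a k
  poch-rescale s a zero    s≉0 = *-identityʳ 1#
  poch-rescale s a (suc k) s≉0 =
    trans (solve 4 (λ x a y b → (x :* a) :* (y :* b) := (x :* y) :* (a :* b)) refl _ _ _ _)
          (*-cong (poch-rescale s a k s≉0) (begin
            (a / s + [ k ]) * s        ≈⟨ distribʳ _ _ _ ⟩
            (a / s) * s + [ k ] * s    ≈⟨ +-cong (/-cancelʳ s≉0) (*-comm _ _) ⟩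
            a + s * [ k ]              ∎))

  poch-ratio-rescale₁ : ∀ {s A B a b k} → s ≉ 0# → B * pochStep s b k ≉ 0# →
    (A * poch (a / s) k) / (B * poch (b / s) k) ≈ (A * pochStep s a k) / (B * pochStep s b k)
  poch-ratio-rescale₁ {s} {A} {B} {a} {b} {k} s≉0 ≉0 = /-cross den≉0 ≉0 (begin
    (A * X) * (B * pochStep s b k)  ≈⟨ *-congˡ (*-congˡ (poch-rescale s b k s≉0)) ⟨
    (A * X) * (B * (Y * pow s k))   ≈⟨ solve 5 (λ A X B Y p → A :* X :* (B :* (Y :* p)) := A :* (X :* p) :* (B :* Y)) refl A X B Y _ ⟩
    (A * (X * pow s k)) * (B * Y)   ≈⟨ *-congʳ (*-congˡ (poch-rescale s a k s≉0)) ⟩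
    (A * pochStep s a k) * (B * Y)  ∎)
    where
    X = poch (a / s) k
    Y = poch (b / s) k
    den≉0 : B * Y ≉ 0#
    den≉0 = *-≉0 (*-≉0⁻ˡ ≉0) (*-≉0⁻ˡ (≉0-resp-≈ (sym (poch-rescale s b k s≉0)) (*-≉0⁻ʳ ≉0)))

  poch-ratio-rescale₂ : ∀ {s a₁ a₂ b₁ b₂ k} → s ≉ 0# → pochStep s b₁ k * pochStep s b₂ k ≉ 0# →
    (poch (a₁ / s) k * poch (a₂ / s) k) / (poch (b₁ / s) k * poch (b₂ / s) k)
      ≈ (pochStep s a₁ k * pochStep s a₂ k) / (pochStep s b₁ k * pochStep s b₂ k)
  poch-ratio-rescale₂ {s} {a₁} {a₂} {b₁} {b₂} {k} s≉0 ≉0 = /-cross den≉0 ≉0 (begin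
    (X₁ * X₂) * (pochStep s b₁ k * pochStep s b₂ k)           ≈⟨ *-congˡ (*-cong (poch-rescale s b₁ k s≉0) (poch-rescale s b₂ k s≉0)) ⟨
    (X₁ * X₂) * ((Y₁ * pow s k) * (Y₂ * pow s k))             ≈⟨ solve 5 (λ x₁ x₂ y₁ y₂ p → (x₁ :* x₂) :* ((y₁ :* p) :* (y₂ :* p))
                                                                           := ((x₁ :* p) :* (x₂ :* p)) :* (y₁ :* y₂)) refl X₁ X₂ Y₁ Y₂ _ ⟩
    ((X₁ * pow s k) * (X₂ * pow s k)) * (Y₁ * Y₂)             ≈⟨ *-congʳ (*-cong (poch-rescale s a₁ k s≉0) (poch-rescale s a₂ k s≉0)) ⟩
    (pochStep s a₁ k * pochStep s a₂ k) * (Y₁ * Y₂)           ∎)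
    where
    X₁ = poch (a₁ / s) k
    X₂ = poch (a₂ / s) k
    Y₁ = poch (b₁ / s) k
    Y₂ = poch (b₂ / s) k
    den≉0 : Y₁ * Y₂ ≉ 0#
    den≉0 = *-≉0 (*-≉0⁻ˡ (≉0-resp-≈ (sym (poch-rescale s b₁ k s≉0)) (*-≉0⁻ˡ ≉0)))
                 (*-≉0⁻ˡ (≉0-resp-≈ (sym (poch-rescale s b₂ k s≉0)) (*-≉0⁻ʳ ≉0)))

module LeftSide {c ℓ} (F : CharZeroField c ℓ) where
  open RisingFactorials F public
  open Polynomials carrierSyntax public

  -- lhs9 with t = 3x - 1, (3/2 - l)_k 2^k written as a step-2 product and
  -- (3/4)^k 2^k 2^k as 3^k.
  lhsNum : ℕ → ℕ → Carrier → ℕ → Carrier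
  lhsNum l n t k = poch (t + 1#) k * poch (1# - [ l ] - t) k * poch (- [ n ]) k * pow [ 3 ] k

  lhsDen : ℕ → ℕ → ℕ → Carrier
  lhsDen l n k = pow [ 2 ] k * poch 1# k * pochStep [ 2 ] ([ 3 ] - [ 2 ] * [ l ]) k * poch (- 1# - [ 3 ] * [ n ]) k

  lhsTerm : ℕ → ℕ → Carrier → ℕ → Carrier
  lhsTerm l n t k = lhsNum l n t k / lhsDen l n k

  lhsSum : ℕ → ℕ → Carrier → Carrier
  lhsSum l n t = sumTo n (lhsTerm l n t)

  [2]≉0 : [ 2 ] ≉ 0#
  [2]≉0 = charZero 1

  poch1≉0 : ∀ k → poch 1# k ≉ 0#
  poch1≉0 k = poch-≉0 1# k (λ j _ → charZero j)

  3-2l+2j≉0 : ∀ l j → ([ 3 ] - [ 2 ] * [ l ]) + [ 2 ] * [ j ] ≉ 0#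
  3-2l+2j≉0 l j = ≉0-via-ℕ (3 ℕ.+ 2 ℕ.* j) (0 ℕ.+ 2 ℕ.* l) ([a+b*n]≈ 3 2 j) ([a+b*n]≈ 0 2 l)
    (solve 2 (λ L J → (con (+ 3) :- con (+ 2) :* L) :+ con (+ 2) :* J
                      := (con (+ 3) :+ con (+ 2) :* J) :- (con (+ 0) :+ con (+ 2) :* L)) refl [ l ] [ j ])
    (3+2j≢2l j l)

  -1-3n+j≉0 : ∀ n j → j ≤ n → (- 1# - [ 3 ] * [ n ]) + [ j ] ≉ 0#
  -1-3n+j≉0 n j j≤n = ≉0-via-ℕ j (1 ℕ.+ 3 ℕ.* n) refl ([a+b*n]≈ 1 3 n)
    (solve 2 (λ N J → (:- con (+ 1) :- con (+ 3) :* N) :+ J := J :- (con (+ 1) :+ con (+ 3) :* N)) refl [ n ] [ j ])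
    (m≤n⇒m≢1+k+3n 0 j≤n)

  lhsDen≉0 : ∀ l n k → k ≤ suc n → lhsDen l n k ≉ 0#
  lhsDen≉0 l n k k≤1+n =
    *-≉0 (*-≉0 (*-≉0 (pow-≉0 _ k [2]≉0) (poch1≉0 k)) (pochStep-≉0 _ _ k (λ j _ → 3-2l+2j≉0 l j)))
         (poch-≉0 _ k (λ j j<k → -1-3n+j≉0 n j (ℕP.≤-pred (ℕP.≤-trans j<k k≤1+n))))

  lhs-contiguity-identity : ∀ t L M →
    κ t L * lhs-n₁ t L M * (lhs-d₀ L M * lhs-d₀ L M)
      ≈ α t L * lhs-n₀ t L M * (lhs-d₁ L M * lhs-d₀ L M) + γ t * lhs-n₂ t L M * (lhs-d₁ L M * lhs-d₀ L M)
  lhs-contiguity-identity = solve 3 (λ t L M →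
    P.κ t L :* P.lhs-n₁ t L M :* (P.lhs-d₀ L M :* P.lhs-d₀ L M)
      := P.α t L :* P.lhs-n₀ t L M :* (P.lhs-d₁ L M :* P.lhs-d₀ L M) :+ P.γ t :* P.lhs-n₂ t L M :* (P.lhs-d₁ L M :* P.lhs-d₀ L M)) refl
    where module P = Polynomials (polySyntax 3)

  lhsTerm-contiguous : ∀ l n t k → k ≤ n →
    κ t [ l ] * lhsTerm (suc l) n t k ≈ α t [ l ] * lhsTerm l n t k + γ t * lhsTerm l n (t + 1#) k
  lhsTerm-contiguous l n t zero    _ =
    solve 3 (λ k g v → k :* v := (k :- g) :* v :+ g :* v) refl (κ t [ l ]) (γ t) (lhsTerm l n t 0)
  lhsTerm-contiguous l n t (suc m) m<n = begin
    κ t L * (lhsNum (suc l) n t (suc m) / lhsDen (suc l) n (suc m))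
      ≈⟨ *-congˡ (*-cong N₁ (⁻¹-cong D₁)) ⟩
    κ t L * ((Z * lhs-n₁ t L M) / (Z′ * lhs-d₁ L M))
      ≈⟨ cross-multiply₃ (≉0-resp-≈ D₀ (lhsDen≉0 l n (suc m) 1+m≤1+n)) (≉0-resp-≈ D₁ (lhsDen≉0 (suc l) n (suc m) 1+m≤1+n))
                         (≉0-resp-≈ D₀ (lhsDen≉0 l n (suc m) 1+m≤1+n)) (lhs-contiguity-identity t L M) ⟩
    α t L * ((Z * lhs-n₀ t L M) / (Z′ * lhs-d₀ L M)) + γ t * ((Z * lhs-n₂ t L M) / (Z′ * lhs-d₀ L M))
      ≈⟨ +-cong (*-congˡ (*-cong N₀ (⁻¹-cong D₀))) (*-congˡ (*-cong N₂ (⁻¹-cong D₀))) ⟨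
    α t L * (lhsNum l n t (suc m) / lhsDen l n (suc m)) + γ t * (lhsNum l n (t + 1#) (suc m) / lhsDen l n (suc m)) ∎
    where
    L = [ l ]
    M = [ m ]
    1+m≤1+n = ℕP.m≤n⇒m≤1+n m<n
    a = poch ((t + 1#) + 1#) m
    b = poch (1# - L - t) m
    p = poch (- [ n ]) m * (- [ n ] + M)
    e = pow [ 3 ] m * [ 3 ]
    Z = a * b * p * e
    q = pow [ 2 ] m * [ 2 ]
    f = poch 1# m * (1# + M)
    s = pochStep [ 2 ] ([ 3 ] - [ 2 ] * L) m
    r = poch (- 1# - [ 3 ] * [ n ]) m * ((- 1# - [ 3 ] * [ n ]) + M)
    Z′ = q * f * s * r
    N₁ : lhsNum (suc l) n t (suc m) ≈ Z * lhs-n₁ t L M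
    N₁ = trans (*-congʳ (*-congʳ (*-cong (poch-unfoldˡ (t + 1#) m)
                 (trans (poch-unfoldˡ _ m) (*-congˡ (poch-cong
                 (solve 2 (λ t L → con (+ 1) :- (con (+ 1) :+ L) :- t :+ con (+ 1) := con (+ 1) :- L :- t) refl t L) m))))))
               (solve 6 (λ u a X b p e → u :* a :* (X :* b) :* p :* e := a :* b :* p :* e :* (u :* X)) refl _ _ _ _ _ _)
    N₀ : lhsNum l n t (suc m) ≈ Z * lhs-n₀ t L M
    N₀ = trans (*-congʳ (*-congʳ (*-congʳ (poch-unfoldˡ (t + 1#) m))))
               (solve 6 (λ u a b W p e → u :* a :* (b :* W) :* p :* e := a :* b :* p :* e :* (u :* W)) refl _ _ _ _ _ _)
    N₂ : lhsNum l n (t + 1#) (suc m) ≈ Z * lhs-n₂ t L M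
    N₂ = trans (*-congʳ (*-congʳ (*-congˡ (trans (poch-unfoldˡ _ m) (*-congˡ (poch-cong
                 (solve 2 (λ t L → con (+ 1) :- L :- (t :+ con (+ 1)) :+ con (+ 1) := con (+ 1) :- L :- t) refl t L) m))))))
               (solve 6 (λ a V X b p e → a :* V :* (X :* b) :* p :* e := a :* b :* p :* e :* (V :* X)) refl _ _ _ _ _ _)
    D₁ : lhsDen (suc l) n (suc m) ≈ Z′ * lhs-d₁ L M
    D₁ = trans (*-congʳ (*-congˡ (trans (pochStep-unfoldˡ _ _ m) (*-congˡ (pochStep-cong
                 (solve 1 (λ L → con (+ 3) :- con (+ 2) :* (con (+ 1) :+ L) :+ con (+ 2) := con (+ 3) :- con (+ 2) :* L) refl L) m)))))
               (solve 5 (λ q f X s r → q :* f :* (X :* s) :* r := q :* f :* s :* r :* X) refl _ _ _ _ _)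
    D₀ : lhsDen l n (suc m) ≈ Z′ * lhs-d₀ L M
    D₀ = solve 5 (λ q f s V r → q :* f :* (s :* V) :* r := q :* f :* s :* r :* V) refl _ _ _ _ _

  lhsSum-contiguous : ∀ l n t →
    κ t [ l ] * lhsSum (suc l) n t ≈ α t [ l ] * lhsSum l n t + γ t * lhsSum l n (t + 1#)
  lhsSum-contiguous l n t = sumTo-relation n (lhsTerm-contiguous l n t)

module LeftSideAtZero {c ℓ} (F : CharZeroField c ℓ) where
  open LeftSide F public

  certificate : ℕ → Carrier → ℕ → Carrier
  certificate n t m = lhsTerm 0 n t m * (certNum t [ m ] [ n ] / certDen [ m ] [ n ])

  residual : ℕ → Carrier → ℕ → Carrier
  residual n t k = ρ₁ [ n ] * lhsTerm 0 (suc n) t k - ρ₀ t [ n ] * lhsTerm 0 n t k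

  bottom³≉0 : ∀ n → bottom³ [ n ] ≉ 0#
  bottom³≉0 n = *-≉0 (*-≉0 (factor≉0 3 (solve 1 (λ N → P.bottom N := con (+ 0) :- (con (+ 4) :+ con (+ 3) :* N)) refl [ n ]))
                           (factor≉0 2 (solve 1 (λ N → P.bottom N :+ con (+ 1) := con (+ 0) :- (con (+ 3) :+ con (+ 3) :* N)) refl [ n ])))
                     (factor≉0 1 (solve 1 (λ N → P.bottom N :+ con (+ 1) :+ con (+ 1) := con (+ 0) :- (con (+ 2) :+ con (+ 3) :* N)) refl [ n ]))
    where
    module P = Polynomials (polySyntax 1)
    factor≉0 : ∀ {x} a → x ≈ 0# - (numeral (suc a) + [ 3 ] * [ n ]) → x ≉ 0#
    factor≉0 a x≈ = ≉0-via-ℕ 0 (suc a ℕ.+ 3 ℕ.* n) refl ([a+b*n]≈ (suc a) 3 n) x≈ (λ ())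

  gap≉0 : ∀ n m → m ≤ n → gap [ m ] [ n ] ≉ 0#
  gap≉0 n m m≤n =
    *-≉0 (≉0-via-ℕ m (3 ℕ.+ 3 ℕ.* n) refl ([a+b*n]≈ 3 3 n)
           (solve 2 (λ M N → P.bottom N :+ (con (+ 1) :+ M) := M :- (con (+ 3) :+ con (+ 3) :* N)) refl [ m ] [ n ])
           (m≤n⇒m≢1+k+3n 2 m≤n))
         (≉0-via-ℕ m (2 ℕ.+ 3 ℕ.* n) refl ([a+b*n]≈ 2 3 n)
           (solve 2 (λ M N → P.bottom N :+ (con (+ 1) :+ (con (+ 1) :+ M)) := M :- (con (+ 2) :+ con (+ 3) :* N)) refl [ m ] [ n ])
           (m≤n⇒m≢1+k+3n 1 m≤n))
    where module P = Polynomials (polySyntax 2)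

  certDen≉0 : ∀ n m → m ≤ n → certDen [ m ] [ n ] ≉ 0#
  certDen≉0 n m m≤n =
    *-≉0 (*-≉0 [2]≉0 (≉0-via-ℕ (3 ℕ.+ 2 ℕ.* m) 0 ([a+b*n]≈ 3 2 m) refl
                        (solve 1 (λ M → con (+ 2) :* M :+ con (+ 3) := (con (+ 3) :+ con (+ 2) :* M) :- con (+ 0)) refl [ m ])
                        (λ ())))
         (≉0-via-ℕ m (1 ℕ.+ 3 ℕ.* n) refl ([a+b*n]≈ 1 3 n)
           (solve 2 (λ M N → M :- con (+ 1) :- con (+ 3) :* N := M :- (con (+ 1) :+ con (+ 3) :* N)) refl [ m ] [ n ])
           (m≤n⇒m≢1+k+3n 0 m≤n))

  termRatioDen≉0 : ∀ n m → m ≤ n → termRatioDen [ m ] [ n ] ≉ 0#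
  termRatioDen≉0 n m m≤n = *-≉0 (*-≉0 (*-≉0 [2]≉0 (charZero m)) (3-2l+2j≉0 0 m)) (-1-3n+j≉0 n m m≤n)

  shiftDen≉0 : ∀ n m → shiftDen [ m ] [ n ] ≉ 0#
  shiftDen≉0 n m = *-≉0 (*-≉0 (*-≉0 [2]≉0 (charZero m)) (3-2l+2j≉0 0 m)) (bottom³≉0 n)

  interleave : ∀ a x b y p z e w → a * x * (b * y) * (p * z) * (e * w) ≈ a * b * p * e * (x * y * z * w)
  interleave = solve 8 (λ a x b y p z e w → a :* x :* (b :* y) :* (p :* z) :* (e :* w) := a :* b :* p :* e :* (x :* y :* z :* w)) refl

  lhsNum-suc : ∀ n t m → lhsNum 0 n t (suc m) ≈ lhsNum 0 n t m * termRatioNum t [ m ] [ n ]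
  lhsNum-suc n t m = interleave _ _ _ _ _ _ _ _

  lhsDen-suc : ∀ n m → lhsDen 0 n (suc m) ≈ lhsDen 0 n m * termRatioDen [ m ] [ n ]
  lhsDen-suc n m = interleave _ _ _ _ _ _ _ _

  poch-bottom-gap : ∀ n m → poch (bottom [ n ]) (suc m) * gap [ m ] [ n ] ≈ bottom³ [ n ] * poch (- 1# - [ 3 ] * [ n ]) m
  poch-bottom-gap n m = begin
    poch b (suc m) * gap [ m ] [ n ]                           ≈⟨ *-assoc _ _ _ ⟨
    poch b (3 ℕ.+ m)                                           ≈⟨ poch-unfoldˡ _ (2 ℕ.+ m) ⟩
    b * poch (b + 1#) (2 ℕ.+ m)                                ≈⟨ *-congˡ (poch-unfoldˡ _ (suc m)) ⟩
    b * ((b + 1#) * poch (b + 1# + 1#) (suc m))                ≈⟨ *-congˡ (*-congˡ (poch-unfoldˡ _ m)) ⟩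
    b * ((b + 1#) * ((b + 1# + 1#) * poch (b + 1# + 1# + 1#) m)) ≈⟨ *-congˡ (*-congˡ (*-congˡ (poch-cong b+3≈ m))) ⟩
    b * ((b + 1#) * ((b + 1# + 1#) * poch (- 1# - [ 3 ] * [ n ]) m))
      ≈⟨ solve 4 (λ b₀ b₁ b₂ r → b₀ :* (b₁ :* (b₂ :* r)) := b₀ :* b₁ :* b₂ :* r) refl _ _ _ _ ⟩
    bottom³ [ n ] * poch (- 1# - [ 3 ] * [ n ]) m              ∎
    where
    b = bottom [ n ]
    b+3≈ : b + 1# + 1# + 1# ≈ - 1# - [ 3 ] * [ n ]
    b+3≈ = solve 1 (λ N → P.bottom N :+ con (+ 1) :+ con (+ 1) :+ con (+ 1) := :- con (+ 1) :- con (+ 3) :* N) refl [ n ]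
      where module P = Polynomials (polySyntax 1)

  lhsTerm-shift : ∀ n t m → m ≤ n →
    lhsTerm 0 (suc n) t (suc m) ≈ (lhsNum 0 n t m * shiftNum t [ m ] [ n ]) / (lhsDen 0 n m * shiftDen [ m ] [ n ])
  lhsTerm-shift n t m m≤n = begin
    lhsTerm 0 (suc n) t (suc m)
      ≈⟨ /-scale (lhsDen≉0 0 (suc n) (suc m) (s≤s (ℕP.m≤n⇒m≤1+n m≤n))) (gap≉0 n m m≤n) ⟩
    (lhsNum 0 (suc n) t (suc m) * gap [ m ] [ n ]) / (lhsDen 0 (suc n) (suc m) * gap [ m ] [ n ])
      ≈⟨ *-cong num (⁻¹-cong den) ⟩
    (lhsNum 0 n t m * shiftNum t [ m ] [ n ]) / (lhsDen 0 n m * shiftDen [ m ] [ n ]) ∎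
    where
    num : lhsNum 0 (suc n) t (suc m) * gap [ m ] [ n ] ≈ lhsNum 0 n t m * shiftNum t [ m ] [ n ]
    num = trans (*-congʳ (trans (*-congʳ (*-congˡ (trans (poch-unfoldˡ _ m)
                  (*-congˡ (poch-cong (solve 1 (λ N → :- (con (+ 1) :+ N) :+ con (+ 1) := :- N) refl [ n ]) m)))))
                  (solve 8 (λ a x b y W p e w → a :* x :* (b :* y) :* (W :* p) :* (e :* w) := a :* b :* p :* e :* (x :* y :* W :* w))
                         refl _ _ _ _ _ _ _ _)))
                (*-assoc _ _ _)
    den : lhsDen 0 (suc n) (suc m) * gap [ m ] [ n ] ≈ lhsDen 0 n m * shiftDen [ m ] [ n ]
    den = trans (*-assoc _ _ _) (trans (*-congˡ (poch-bottom-gap n m))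
            (solve 8 (λ q x f y s z B r → q :* x :* (f :* y) :* (s :* z) :* (B :* r) := q :* f :* s :* r :* (x :* y :* z :* B))
                   refl _ _ _ _ _ _ _ _))

  certificate≈ : ∀ n t m → m ≤ n →
    certificate n t m ≈ (lhsNum 0 n t m * certNum t [ m ] [ n ]) / (lhsDen 0 n m * certDen [ m ] [ n ])
  certificate≈ n t m m≤n = /-*-/ (lhsDen≉0 0 n m (ℕP.m≤n⇒m≤1+n m≤n)) (certDen≉0 n m m≤n)

  certificate-suc≈ : ∀ n t m → suc m ≤ n →
    certificate n t (suc m) ≈ (lhsNum 0 n t m * (termRatioNum t [ m ] [ n ] * certNum t [ suc m ] [ n ]))
                              / (lhsDen 0 n m * (termRatioDen [ m ] [ n ] * certDen [ suc m ] [ n ]))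
  certificate-suc≈ n t m 1+m≤n = begin
    lhsTerm 0 n t (suc m) * (certNum t [ suc m ] [ n ] / certDen [ suc m ] [ n ])
      ≈⟨ /-*-/ (lhsDen≉0 0 n (suc m) (ℕP.m≤n⇒m≤1+n 1+m≤n)) (certDen≉0 n (suc m) 1+m≤n) ⟩
    (lhsNum 0 n t (suc m) * certNum t [ suc m ] [ n ]) / (lhsDen 0 n (suc m) * certDen [ suc m ] [ n ])
      ≈⟨ *-cong (*-congʳ (lhsNum-suc n t m)) (⁻¹-cong (*-congʳ (lhsDen-suc n m))) ⟩
    ((lhsNum 0 n t m * termRatioNum t [ m ] [ n ]) * certNum t [ suc m ] [ n ])
      / ((lhsDen 0 n m * termRatioDen [ m ] [ n ]) * certDen [ suc m ] [ n ])
      ≈⟨ *-cong (*-assoc _ _ _) (⁻¹-cong (*-assoc _ _ _)) ⟩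
    (lhsNum 0 n t m * (termRatioNum t [ m ] [ n ] * certNum t [ suc m ] [ n ]))
      / (lhsDen 0 n m * (termRatioDen [ m ] [ n ] * certDen [ suc m ] [ n ])) ∎

  telescoping-identity : ∀ t M N →
    certNum t M N * ((1# + M) * (certDen (1# + M) N * bottom³ N))
      + (ρ₁ N * (shiftNum t M N * (((- 1# - [ 3 ] * N) + M) * certDen (1# + M) N))
         - ρ₀ t N * (termRatioNum t M N * (certDen (1# + M) N * bottom³ N)))
      ≈ termRatioNum t M N * certNum t (1# + M) N * bottom³ N
  telescoping-identity = solve 3 (λ t M N →
    P.certNum t M N :* ((con (+ 1) :+ M) :* (P.certDen (con (+ 1) :+ M) N :* P.bottom³ N))
      :+ (P.ρ₁ N :* (P.shiftNum t M N :* (((:- con (+ 1) :- con (+ 3) :* N) :+ M) :* P.certDen (con (+ 1) :+ M) N))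
          :- P.ρ₀ t N :* (P.termRatioNum t M N :* (P.certDen (con (+ 1) :+ M) N :* P.bottom³ N)))
      := P.termRatioNum t M N :* P.certNum t (con (+ 1) :+ M) N :* P.bottom³ N) refl
    where module P = Polynomials (polySyntax 3)

  telescoping-step : ∀ n t m → suc m ≤ n → certificate n t m + residual n t (suc m) ≈ certificate n t (suc m)
  telescoping-step n t m 1+m≤n = begin
    certificate n t m + residual n t (suc m)
      ≈⟨ +-cong (certificate≈ n t m m≤n)
                (+-cong (*-congˡ (lhsTerm-shift n t m m≤n)) (-‿cong (*-congˡ (*-cong (lhsNum-suc n t m) (⁻¹-cong (lhsDen-suc n m)))))) ⟩
    (Z * certNum t M N) / (Z′ * certDen M N)
      + (ρ₁ N * ((Z * shiftNum t M N) / (Z′ * shiftDen M N)) - ρ₀ t N * ((Z * termRatioNum t M N) / (Z′ * termRatioDen M N)))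
      ≈⟨ common-denominator₄ (lhsDen≉0 0 n m (ℕP.m≤n⇒m≤1+n m≤n)) D≉0
           (solve 2 (λ M N → P.certDen M N :* ((con (+ 1) :+ M) :* (P.certDen (con (+ 1) :+ M) N :* P.bottom³ N)) := P.commonDen M N) refl M N)
           (solve 2 (λ M N → P.shiftDen M N :* (((:- con (+ 1) :- con (+ 3) :* N) :+ M) :* P.certDen (con (+ 1) :+ M) N) := P.commonDen M N) refl M N)
           (solve 2 (λ M N → P.termRatioDen M N :* (P.certDen (con (+ 1) :+ M) N :* P.bottom³ N) := P.commonDen M N) refl M N)
           (solve 2 (λ M N → P.termRatioDen M N :* P.certDen (con (+ 1) :+ M) N :* P.bottom³ N := P.commonDen M N) refl M N)
           (telescoping-identity t M N) ⟩
    (Z * (termRatioNum t M N * certNum t (1# + M) N)) / (Z′ * (termRatioDen M N * certDen (1# + M) N))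
      ≈⟨ certificate-suc≈ n t m 1+m≤n ⟨
    certificate n t (suc m) ∎
    where
    m≤n = ℕP.<⇒≤ 1+m≤n
    M = [ m ]
    N = [ n ]
    Z = lhsNum 0 n t m
    Z′ = lhsDen 0 n m
    module P = Polynomials (polySyntax 2)
    D≉0 : commonDen M N ≉ 0#
    D≉0 = *-≉0 (*-≉0 (termRatioDen≉0 n m m≤n) (certDen≉0 n (suc m) 1+m≤n)) (bottom³≉0 n)

  telescoping : ∀ n t m → m ≤ n → sumTo m (residual n t) ≈ certificate n t m
  telescoping n t zero _ = begin
    ρ₁ [ n ] * v - ρ₀ t [ n ] * v    ≈⟨ solve 3 (λ a b v → a :* v :- b :* v := v :* (a :- b)) refl _ _ v ⟩
    v * (ρ₁ [ n ] - ρ₀ t [ n ])      ≈⟨ *-congˡ (*-/-cancelʳ (certDen≉0 n 0 z≤n)) ⟨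
    v * ((ρ₁ [ n ] - ρ₀ t [ n ]) * certDen 0# [ n ] / certDen 0# [ n ])
      ≈⟨ *-congˡ (/-congˡ (solve 2 (λ t N → (P.ρ₁ N :- P.ρ₀ t N) :* P.certDen (con (+ 0)) N := P.certNum t (con (+ 0)) N) refl t [ n ])) ⟩
    v * (certNum t 0# [ n ] / certDen 0# [ n ]) ∎
    where
    v = lhsTerm 0 n t 0
    module P = Polynomials (polySyntax 2)
  telescoping n t (suc m) 1+m≤n =
    trans (+-congʳ (telescoping n t m (ℕP.<⇒≤ 1+m≤n))) (telescoping-step n t m 1+m≤n)

  telescoping-end : ∀ n t → certificate n t n + ρ₁ [ n ] * lhsTerm 0 (suc n) t (suc n) ≈ 0#
  telescoping-end n t = begin
    certificate n t n + ρ₁ N * lhsTerm 0 (suc n) t (suc n)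
      ≈⟨ +-cong (certificate≈ n t n ℕP.≤-refl) (*-congˡ (lhsTerm-shift n t n ℕP.≤-refl)) ⟩
    (Z * certNum t N N) / (Z′ * certDen N N) + ρ₁ N * ((Z * shiftNum t N N) / (Z′ * shiftDen N N))
      ≈⟨ common-denominator₂≈0 (lhsDen≉0 0 n n (ℕP.m≤n⇒m≤1+n ℕP.≤-refl))
           (*-≉0 (certDen≉0 n n ℕP.≤-refl) (shiftDen≉0 n n)) refl (*-comm _ _)
           (solve 2 (λ t N → P.certNum t N N :* P.shiftDen N N :+ P.ρ₁ N :* (P.shiftNum t N N :* P.certDen N N) := con (+ 0)) refl t N) ⟩
    0# ∎
    where
    N = [ n ]
    Z = lhsNum 0 n t n
    Z′ = lhsDen 0 n n
    module P = Polynomials (polySyntax 2)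

  lhsSum-recurrence : ∀ n t → ρ₁ [ n ] * lhsSum 0 (suc n) t ≈ ρ₀ t [ n ] * lhsSum 0 n t
  lhsSum-recurrence n t = begin
    ρ₁ N * (S₁ + X)
      ≈⟨ solve 5 (λ a b S₁ S₀ X → a :* (S₁ :+ X) := a :* S₁ :- b :* S₀ :+ a :* X :+ b :* S₀) refl (ρ₁ N) (ρ₀ t N) S₁ S₀ X ⟩
    ρ₁ N * S₁ - ρ₀ t N * S₀ + ρ₁ N * X + ρ₀ t N * S₀
      ≈⟨ +-congʳ (+-congʳ sums≈certificate) ⟩
    certificate n t n + ρ₁ N * X + ρ₀ t N * S₀
      ≈⟨ +-congʳ (telescoping-end n t) ⟩
    0# + ρ₀ t N * S₀
      ≈⟨ +-identityˡ _ ⟩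
    ρ₀ t N * S₀ ∎
    where
    N = [ n ]
    S₁ = sumTo n (lhsTerm 0 (suc n) t)
    S₀ = lhsSum 0 n t
    X = lhsTerm 0 (suc n) t (suc n)
    sums≈certificate : ρ₁ N * S₁ - ρ₀ t N * S₀ ≈ certificate n t n
    sums≈certificate = begin
      ρ₁ N * S₁ - ρ₀ t N * S₀ ≈⟨ +-cong (*-distribˡ-sumTo n _ _) (-‿cong (*-distribˡ-sumTo n _ _)) ⟩
      sumTo n (λ k → ρ₁ N * lhsTerm 0 (suc n) t k) - sumTo n (λ k → ρ₀ t N * lhsTerm 0 n t k) ≈⟨ sumTo-sub n _ _ ⟨
      sumTo n (residual n t) ≈⟨ telescoping n t n ℕP.≤-refl ⟩
      certificate n t n ∎

  -- ((u + 3)/3)_n ((3 - u)/3)_n / ((2/3)_n (4/3)_n), with the factors 3^n cleared.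
  closedForm : ℕ → Carrier → Carrier
  closedForm n u = (pochStep [ 3 ] (u + [ 3 ]) n * pochStep [ 3 ] ([ 3 ] - u) n)
                   / (pochStep [ 3 ] [ 2 ] n * pochStep [ 3 ] [ 4 ] n)

  closedForm-cong : ∀ n {u v} → u ≈ v → closedForm n u ≈ closedForm n v
  closedForm-cong n u≈v = *-congʳ (*-cong (pochStep-cong (+-congʳ u≈v) n) (pochStep-cong (+-congˡ (-‿cong u≈v)) n))

  1+a+3j≉0 : ∀ a j → numeral (suc a) + [ 3 ] * [ j ] ≉ 0#
  1+a+3j≉0 a j = ≉0-via-ℕ (suc a ℕ.+ 3 ℕ.* j) 0 ([a+b*n]≈ (suc a) 3 j) refl
    (solve 1 (λ x → x := x :- con (+ 0)) refl _) (λ ())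

  ρ₁≉0 : ∀ n → ρ₁ [ n ] ≉ 0#
  ρ₁≉0 n = *-≉0 (1+a+3j≉0 1 n) (1+a+3j≉0 3 n)

  closedForm-recurrence : ∀ n u → ρ₁ [ n ] * closedForm (suc n) u ≈ ρ₀ u [ n ] * closedForm n u
  closedForm-recurrence n u = begin
    ρ₁ [ n ] * ((A′ * B′) / (C′ * D′)) ≈⟨ *-/-assoc _ _ _ ⟩
    (ρ₁ [ n ] * (A′ * B′)) / (C′ * D′)
      ≈⟨ /-cross (*-≉0 (step≉0 1 (suc n)) (step≉0 3 (suc n))) (*-≉0 (step≉0 1 n) (step≉0 3 n))
           (solve 8 (λ A B C D x y a b → a :* b :* (A :* x :* (B :* y)) :* (C :* D) := x :* y :* (A :* B) :* (C :* a :* (D :* b)))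
                  refl _ _ _ _ _ _ _ _) ⟩
    (ρ₀ u [ n ] * (A * B)) / (C * D)    ≈⟨ *-/-assoc _ _ _ ⟨
    ρ₀ u [ n ] * closedForm n u ∎
    where
    A = pochStep [ 3 ] (u + [ 3 ]) n
    B = pochStep [ 3 ] ([ 3 ] - u) n
    C = pochStep [ 3 ] [ 2 ] n
    D = pochStep [ 3 ] [ 4 ] n
    A′ = pochStep [ 3 ] (u + [ 3 ]) (suc n)
    B′ = pochStep [ 3 ] ([ 3 ] - u) (suc n)
    C′ = pochStep [ 3 ] [ 2 ] (suc n)
    D′ = pochStep [ 3 ] [ 4 ] (suc n)
    step≉0 : ∀ a m → pochStep [ 3 ] (numeral (suc a)) m ≉ 0#
    step≉0 a m = pochStep-≉0 _ _ m (λ j _ → 1+a+3j≉0 a j)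

  lhsSum≈closedForm : ∀ n t → lhsSum 0 n t ≈ closedForm n t
  lhsSum≈closedForm zero    t = trans (x/x≈1 (*-≉0 (*-≉0 (*-≉0 1≉0 1≉0) 1≉0) 1≉0)) (sym (x/x≈1 (*-≉0 1≉0 1≉0)))
  lhsSum≈closedForm (suc n) t = *-cancelʳ (ρ₁≉0 n) (begin
    lhsSum 0 (suc n) t * ρ₁ [ n ]  ≈⟨ *-comm _ _ ⟩
    ρ₁ [ n ] * lhsSum 0 (suc n) t  ≈⟨ lhsSum-recurrence n t ⟩
    ρ₀ t [ n ] * lhsSum 0 n t      ≈⟨ *-congˡ (lhsSum≈closedForm n t) ⟩
    ρ₀ t [ n ] * closedForm n t    ≈⟨ closedForm-recurrence n t ⟨
    ρ₁ [ n ] * closedForm (suc n) t ≈⟨ *-comm _ _ ⟩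
    closedForm (suc n) t * ρ₁ [ n ] ∎)

module RightSide {c ℓ} (F : CharZeroField c ℓ) where
  open LeftSideAtZero F public

  -- rhs9 with t = 3x - 1: the prefactor and the summand i up to closedForm,
  -- with (3x - 1/2)_l and (-1/2)_l written as step-2 products over 2^l.
  rhsNum : ℕ → Carrier → ℕ → Carrier
  rhsNum l t i = poch t l * pochStep [ 2 ] ([ 2 ] * t + 1#) l * ((t + [ i ]) * (t + [ i ]))
                 * poch (- [ l ]) i * poch ([ 2 ] * t) i

  rhsDen : ℕ → Carrier → ℕ → Carrier
  rhsDen l t i = poch ([ 2 ] * t + 1#) l * pochStep [ 2 ] (- 1#) l * (t * t)
                 * poch 1# i * poch ([ 2 ] * t + [ l ] + 1#) i

  rhsWeight : ℕ → Carrier → ℕ → Carrier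
  rhsWeight l t i = rhsNum l t i / rhsDen l t i

  rhsSum : ℕ → ℕ → Carrier → Carrier
  rhsSum l n t = sumTo l (λ i → rhsWeight l t i * closedForm n (t + [ i ]))

  -- The factors 2t + 1, ..., 2t + 2l are those of (6x - 1)_l and (6x + l - 1)_l.
  Admissible : ℕ → Carrier → Set ℓ
  Admissible l t = t ≉ 0# × (∀ j → j < l ℕ.+ l → [ 2 ] * t + [ suc j ] ≉ 0#)

  2+l+l≡1+l+1+l : ∀ l → 2 ℕ.+ (l ℕ.+ l) ≡ suc l ℕ.+ suc l
  2+l+l≡1+l+1+l l = ≡.cong suc (≡.sym (ℕP.+-suc l l))

  admissible-pred : ∀ {l t} → Admissible (suc l) t → Admissible l t
  admissible-pred {l} (t≉0 , h) =
    t≉0 , λ j j<2l → h j (ℕP.≤-trans j<2l (ℕP.≤-trans (ℕP.m≤n+m (l ℕ.+ l) 2) (ℕP.≤-reflexive (2+l+l≡1+l+1+l l))))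

  -1+2i≉0 : ∀ i → - 1# + [ 2 ] * [ i ] ≉ 0#
  -1+2i≉0 i = ≉0-via-ℕ (0 ℕ.+ 2 ℕ.* i) 1 ([a+b*n]≈ 0 2 i) (+-identityʳ 1#)
    (solve 1 (λ I → :- con (+ 1) :+ con (+ 2) :* I := (con (+ 0) :+ con (+ 2) :* I) :- con (+ 1)) refl [ i ])
    (2i≢1 i)

  pochStep-odd≉0 : ∀ l → pochStep [ 2 ] (- 1#) l ≉ 0#
  pochStep-odd≉0 l = pochStep-≉0 _ _ l (λ i _ → -1+2i≉0 i)

  module Factors {l t} (H : Admissible (suc l) t) where

    t≉0 : t ≉ 0#
    t≉0 = proj₁ H

    2t+1+j≉0 : ∀ {x} j → j < 2 ℕ.+ (l ℕ.+ l) → x ≈ [ 2 ] * t + [ suc j ] → x ≉ 0#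
    2t+1+j≉0 j j<2+2l x≈ = ≉0-resp-≈ (sym x≈) (proj₂ H j (ℕP.≤-trans j<2+2l (ℕP.≤-reflexive (2+l+l≡1+l+1+l l))))

    l+i<2+l+l : ∀ {i} → i ≤ l → suc (l ℕ.+ i) < 2 ℕ.+ (l ℕ.+ l)
    l+i<2+l+l i≤l = s≤s (s≤s (ℕP.+-monoʳ-≤ l i≤l))

    [l+i] : ∀ i → [ l ℕ.+ i ] ≈ [ l ] + [ i ]
    [l+i] = [m+n]≈[m]+[n] l

    2t+1≉0 : [ 2 ] * t + 1# ≉ 0#
    2t+1≉0 = 2t+1+j≉0 0 (s≤s z≤n) (solve 1 (λ t → con (+ 2) :* t :+ con (+ 1) := con (+ 2) :* t :+ (con (+ 1) :+ con (+ 0))) refl t)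

    t+1≉0 : t + 1# ≉ 0#
    t+1≉0 = *-≉0⁻ʳ (2t+1+j≉0 1 (s≤s (s≤s z≤n))
              (solve 1 (λ t → con (+ 2) :* (t :+ con (+ 1)) := con (+ 2) :* t :+ (con (+ 1) :+ (con (+ 1) :+ con (+ 0)))) refl t))

    2t+1+1≉0 : [ 2 ] * t + 1# + 1# ≉ 0#
    2t+1+1≉0 = 2t+1+j≉0 1 (s≤s (s≤s z≤n))
      (solve 1 (λ t → con (+ 2) :* t :+ con (+ 1) :+ con (+ 1) := con (+ 2) :* t :+ (con (+ 1) :+ (con (+ 1) :+ con (+ 0)))) refl t)

    2t+1+i≉0 : ∀ i → i ≤ l → [ 2 ] * t + 1# + [ i ] ≉ 0#
    2t+1+i≉0 i i≤l = 2t+1+j≉0 i (s≤s (ℕP.≤-trans i≤l (ℕP.≤-trans (ℕP.m≤m+n l l) (ℕP.n≤1+n _))))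
      (solve 2 (λ t I → con (+ 2) :* t :+ con (+ 1) :+ I := con (+ 2) :* t :+ (con (+ 1) :+ I)) refl t [ i ])

    2t+l+1≉0 : [ 2 ] * t + [ l ] + 1# ≉ 0#
    2t+l+1≉0 = 2t+1+j≉0 l (ℕP.≤-trans (ℕP.n≤1+n _) (s≤s (s≤s (ℕP.m≤m+n l l))))
      (solve 2 (λ t L → con (+ 2) :* t :+ L :+ con (+ 1) := con (+ 2) :* t :+ (con (+ 1) :+ L)) refl t [ l ])

    2t+l+2≉0 : [ 2 ] * t + [ l ] + 1# + 1# ≉ 0#
    2t+l+2≉0 = 2t+1+j≉0 (suc l) (s≤s (s≤s (ℕP.m≤m+n l l)))
      (solve 2 (λ t L → con (+ 2) :* t :+ L :+ con (+ 1) :+ con (+ 1) := con (+ 2) :* t :+ (con (+ 1) :+ (con (+ 1) :+ L))) refl t [ l ])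

    2t+1+1+l≉0 : [ 2 ] * t + 1# + (1# + [ l ]) ≉ 0#
    2t+1+1+l≉0 = 2t+1+j≉0 (suc l) (s≤s (s≤s (ℕP.m≤m+n l l)))
      (solve 2 (λ t L → con (+ 2) :* t :+ con (+ 1) :+ (con (+ 1) :+ L) := con (+ 2) :* t :+ (con (+ 1) :+ (con (+ 1) :+ L))) refl t [ l ])

    2t+l+2+i≉0 : ∀ i → i ≤ l → [ 2 ] * t + [ l ] + 1# + 1# + [ i ] ≉ 0#
    2t+l+2+i≉0 i i≤l = 2t+1+j≉0 (suc (l ℕ.+ i)) (l+i<2+l+l i≤l) (begin
      [ 2 ] * t + [ l ] + 1# + 1# + [ i ] ≈⟨ solve 3 (λ t L I → con (+ 2) :* t :+ L :+ con (+ 1) :+ con (+ 1) :+ I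
                                                        := con (+ 2) :* t :+ (con (+ 1) :+ (con (+ 1) :+ (L :+ I)))) refl t [ l ] [ i ] ⟩
      [ 2 ] * t + (1# + (1# + ([ l ] + [ i ]))) ≈⟨ +-congˡ (+-congˡ (+-congˡ ([l+i] i))) ⟨
      [ 2 ] * t + [ suc (suc (l ℕ.+ i)) ] ∎)

    2t+1+l+1+i≉0 : ∀ i → i ≤ l → [ 2 ] * t + (1# + [ l ]) + 1# + [ i ] ≉ 0#
    2t+1+l+1+i≉0 i i≤l = ≉0-resp-≈ (solve 3 (λ t L I → con (+ 2) :* t :+ L :+ con (+ 1) :+ con (+ 1) :+ I
                                              := con (+ 2) :* t :+ (con (+ 1) :+ L) :+ con (+ 1) :+ I) refl t [ l ] [ i ])
                                   (2t+l+2+i≉0 i i≤l)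

    κ≉0 : κ t [ l ] ≉ 0#
    κ≉0 = *-≉0 (≉0-via-ℕ 1 (0 ℕ.+ 2 ℕ.* l) (+-identityʳ 1#) ([a+b*n]≈ 0 2 l)
                  (solve 1 (λ L → con (+ 1) :- con (+ 2) :* L := con (+ 1) :- (con (+ 0) :+ con (+ 2) :* L)) refl [ l ])
                  (λ 1≡2l → 2i≢1 l (≡.sym 1≡2l)))
               2t+l+1≉0

    shifted : Admissible l (t + 1#)
    shifted = t+1≉0 , λ j j<2l → 2t+1+j≉0 (suc (suc j)) (s≤s (s≤s j<2l))
      (solve 2 (λ t J → con (+ 2) :* (t :+ con (+ 1)) :+ (con (+ 1) :+ J) := con (+ 2) :* t :+ (con (+ 1) :+ (con (+ 1) :+ (con (+ 1) :+ J)))) refl t [ j ])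

  rhs-contiguity-identity : ∀ t L J →
    κ t L * rhs-n₁ t L J * (rhs-d₀ t L J * rhs-d₂ t L J)
      ≈ α t L * rhs-n₀ t L J * (rhs-d₁ t L J * rhs-d₂ t L J) + γ t * rhs-n₂ t L J * (rhs-d₁ t L J * rhs-d₀ t L J)
  rhs-contiguity-identity = solve 3 (λ t L J →
    P.κ t L :* P.rhs-n₁ t L J :* (P.rhs-d₀ t L J :* P.rhs-d₂ t L J)
      := P.α t L :* P.rhs-n₀ t L J :* (P.rhs-d₁ t L J :* P.rhs-d₂ t L J) :+ P.γ t :* P.rhs-n₂ t L J :* (P.rhs-d₁ t L J :* P.rhs-d₀ t L J)) refl
    where module P = Polynomials (polySyntax 3)

  rhsWeight-contiguous-zero : ∀ {l t} → Admissible (suc l) t →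
    κ t [ l ] * rhsWeight (suc l) t 0 ≈ α t [ l ] * rhsWeight l t 0 + γ t * 0#
  rhsWeight-contiguous-zero {l} {t} H = begin
    κ t L * rhsWeight (suc l) t 0
      ≈⟨ *-congˡ (*-cong (unit-factors _ _ _ _ _) (⁻¹-cong (unit-factors _ _ _ _ _))) ⟩
    κ t L * ((Z * rhs-n₁⁰ t L) / (Z′ * rhs-d₁⁰ t L))
      ≈⟨ cross-multiply₃ Z′1≉0 (*-≉0 Z′≉0 (*-≉0 (2t+1+i≉0 l ℕP.≤-refl) (-1+2i≉0 l))) Z′1≉0
           (solve 2 (λ t L → P.κ t L :* P.rhs-n₁⁰ t L :* (con (+ 1) :* con (+ 1))
                             := P.α t L :* con (+ 1) :* (P.rhs-d₁⁰ t L :* con (+ 1)) :+ P.γ t :* con (+ 0) :* (P.rhs-d₁⁰ t L :* con (+ 1))) refl t L) ⟩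
    α t L * ((Z * 1#) / (Z′ * 1#)) + γ t * ((Z * 0#) / (Z′ * 1#))
      ≈⟨ +-cong (*-congˡ (sym (*-cong (drop-units _ _ _) (⁻¹-cong (drop-units _ _ _))))) (*-congˡ (trans (/-congˡ (zeroʳ Z)) (0/y≈0 _))) ⟩
    α t L * rhsWeight l t 0 + γ t * 0# ∎
    where
    open Factors H
    module P = Polynomials (polySyntax 2)
    L = [ l ]
    Z = poch t l * pochStep [ 2 ] ([ 2 ] * t + 1#) l * ((t + 0#) * (t + 0#))
    Z′ = poch ([ 2 ] * t + 1#) l * pochStep [ 2 ] (- 1#) l * (t * t)
    Z′≉0 : Z′ ≉ 0#
    Z′≉0 = *-≉0 (*-≉0 (poch-≉0 _ l (λ i i<l → 2t+1+i≉0 i (ℕP.<⇒≤ i<l))) (pochStep-odd≉0 l)) (*-≉0 t≉0 t≉0)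
    Z′1≉0 : Z′ * 1# ≉ 0#
    Z′1≉0 = *-≉0 Z′≉0 1≉0
    unit-factors : ∀ A x B y S → A * x * (B * y) * S * 1# * 1# ≈ A * B * S * (x * y)
    unit-factors = solve 5 (λ A x B y S → A :* x :* (B :* y) :* S :* con (+ 1) :* con (+ 1) := A :* B :* S :* (x :* y)) refl
    drop-units : ∀ A B S → A * B * S * 1# * 1# ≈ A * B * S * 1#
    drop-units = solve 3 (λ A B S → A :* B :* S :* con (+ 1) :* con (+ 1) := A :* B :* S :* con (+ 1)) refl

  rhsWeight-contiguous-suc : ∀ {l t} → Admissible (suc l) t → ∀ j → j ≤ l →
    κ t [ l ] * rhsWeight (suc l) t (suc j) ≈ α t [ l ] * rhsWeight l t (suc j) + γ t * rhsWeight l (t + 1#) j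
  rhsWeight-contiguous-suc {l} {t} H j j≤l = begin
    κ t L * rhsWeight (suc l) t (suc j)
      ≈⟨ *-congˡ (*-cong N₁ (⁻¹-cong D₁)) ⟩
    κ t L * ((Z * rhs-n₁ t L J) / (Z′ * rhs-d₁ t L J))
      ≈⟨ cross-multiply₃ Z′d₀≉0 Z′d₁≉0 Z′d₂≉0 (rhs-contiguity-identity t L J) ⟩
    α t L * ((Z * rhs-n₀ t L J) / (Z′ * rhs-d₀ t L J)) + γ t * ((Z * rhs-n₂ t L J) / (Z′ * rhs-d₂ t L J))
      ≈⟨ +-cong (*-congˡ (*-cong N₀ (⁻¹-cong D₀))) (*-congˡ shifted-weight) ⟨
    α t L * rhsWeight l t (suc j) + γ t * rhsWeight l (t + 1#) j ∎
    where
    open Factors H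
    L = [ l ]
    J = [ j ]
    A = poch t l
    B = pochStep [ 2 ] ([ 2 ] * t + 1#) l
    S = (t + (1# + J)) * (t + (1# + J))
    p = poch (- L) j
    q = poch ([ 2 ] * t + 1#) j
    Z = A * B * S * p * q
    D = poch ([ 2 ] * t + 1#) l
    E = pochStep [ 2 ] (- 1#) l
    T = t * t
    f = poch 1# j
    y = rhs-y t L
    r = poch y j
    Z′ = D * E * T * f * r
    R = ([ 2 ] * t + 1# + 1#) * y * t
    K = t * ([ 2 ] * t + 1#) * ([ 2 ] * t + 1#) * R

    N₁ : rhsNum (suc l) t (suc j) ≈ Z * rhs-n₁ t L J
    N₁ = trans (*-cong (*-congˡ (trans (poch-unfoldˡ _ j)
                 (*-congˡ (poch-cong (solve 1 (λ L → :- (con (+ 1) :+ L) :+ con (+ 1) := :- L) refl L) j))))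
                 (poch-unfoldˡ _ j))
               (solve 9 (λ A x B y S u p v q → A :* x :* (B :* y) :* S :* (u :* p) :* (v :* q)
                                              := A :* B :* S :* p :* q :* (x :* y :* u :* v)) refl _ _ _ _ _ _ _ _ _)
    N₀ : rhsNum l t (suc j) ≈ Z * rhs-n₀ t L J
    N₀ = trans (*-congˡ (poch-unfoldˡ _ j))
               (solve 7 (λ A B S p w v q → A :* B :* S :* (p :* w) :* (v :* q) := A :* B :* S :* p :* q :* (w :* v)) refl _ _ _ _ _ _ _)
    N₂K : rhsNum l (t + 1#) j * K ≈ Z * rhs-n₂ t L J
    N₂K = trans (solve 9 (λ P₁ P₂ S p P₅ t k₁ k₂ R → P₁ :* P₂ :* S :* p :* P₅ :* (t :* k₁ :* k₂ :* R)
                                                  := t :* P₁ :* (k₁ :* P₂) :* S :* p :* (k₂ :* P₅) :* R) refl _ _ _ _ _ _ _ _ _)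
                (trans (*-congʳ (*-cong (*-cong (*-cong (*-cong A-shift B-shift) (*-cong (t+1+J≈ t J) (t+1+J≈ t J))) refl) q-shift))
                       (solve 9 (λ A x B y S p q z R → A :* x :* (B :* y) :* S :* p :* (q :* z) :* R
                                                      := A :* B :* S :* p :* q :* (x :* y :* z :* R)) refl _ _ _ _ _ _ _ _ _))
      where
      t+1+J≈ : ∀ t J → t + 1# + J ≈ t + (1# + J)
      t+1+J≈ = solve 2 (λ t J → t :+ con (+ 1) :+ J := t :+ (con (+ 1) :+ J)) refl
      A-shift : t * poch (t + 1#) l ≈ A * (t + L)
      A-shift = sym (poch-unfoldˡ t l)
      B-shift : ([ 2 ] * t + 1#) * pochStep [ 2 ] ([ 2 ] * (t + 1#) + 1#) l ≈ B * (([ 2 ] * t + 1#) + [ 2 ] * L)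
      B-shift = trans (*-congˡ (sym (pochStep-cong (solve 1 (λ t → con (+ 2) :* t :+ con (+ 1) :+ con (+ 2) := con (+ 2) :* (t :+ con (+ 1)) :+ con (+ 1)) refl t) l)))
                      (sym (pochStep-unfoldˡ _ _ l))
      q-shift : ([ 2 ] * t + 1#) * poch ([ 2 ] * (t + 1#)) j ≈ q * (([ 2 ] * t + 1#) + J)
      q-shift = trans (*-congˡ (sym (poch-cong (solve 1 (λ t → con (+ 2) :* t :+ con (+ 1) :+ con (+ 1) := con (+ 2) :* (t :+ con (+ 1))) refl t) j)))
                      (sym (poch-unfoldˡ _ j))
    D₁ : rhsDen (suc l) t (suc j) ≈ Z′ * rhs-d₁ t L J
    D₁ = trans (*-congˡ (*-congʳ (poch-cong (solve 2 (λ t L → con (+ 2) :* t :+ (con (+ 1) :+ L) :+ con (+ 1) := con (+ 2) :* t :+ L :+ con (+ 1) :+ con (+ 1)) refl t L) j)))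
               (solve 9 (λ D x E y T f u r v → D :* x :* (E :* y) :* T :* (f :* u) :* (r :* v)
                                              := D :* E :* T :* f :* r :* (x :* y :* u :* v)) refl _ _ _ _ _ _ _ _ _)
    D₀ : rhsDen l t (suc j) ≈ Z′ * rhs-d₀ t L J
    D₀ = trans (*-congˡ (poch-unfoldˡ _ j))
               (solve 7 (λ D E T f u w r → D :* E :* T :* (f :* u) :* (w :* r) := D :* E :* T :* f :* r :* (u :* w)) refl _ _ _ _ _ _ _)
    D₂K : rhsDen l (t + 1#) j * K ≈ Z′ * rhs-d₂ t L J
    D₂K = trans (solve 11 (λ P₃ E U f P₄ t k₁ k₁′ k₂ y t′ → P₃ :* E :* U :* f :* P₄ :* (t :* k₁ :* k₁′ :* (k₂ :* y :* t′))
                                                         := k₁ :* (k₂ :* P₃) :* E :* (t :* t′) :* f :* (y :* P₄) :* (U :* k₁′)) refl _ _ _ _ _ _ _ _ _ _ _)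
                (trans (*-congʳ (*-cong (*-congʳ (*-congʳ (*-congʳ D-shift))) r-shift))
                       (solve 10 (λ D a₁ a₂ E T f r a₃ U k₁ → D :* a₁ :* a₂ :* E :* T :* f :* (r :* a₃) :* (U :* k₁)
                                                             := D :* E :* T :* f :* r :* (a₁ :* a₂ :* U :* a₃ :* k₁)) refl _ _ _ _ _ _ _ _ _ _))
      where
      D-shift : ([ 2 ] * t + 1#) * (([ 2 ] * t + 1# + 1#) * poch ([ 2 ] * (t + 1#) + 1#) l)
                ≈ D * (([ 2 ] * t + 1#) + L) * (([ 2 ] * t + 1#) + (1# + L))
      D-shift = sym (trans (poch-unfoldˡ _ (suc l)) (*-congˡ (trans (poch-unfoldˡ _ l)
                  (*-congˡ (poch-cong (solve 1 (λ t → con (+ 2) :* t :+ con (+ 1) :+ con (+ 1) :+ con (+ 1) := con (+ 2) :* (t :+ con (+ 1)) :+ con (+ 1)) refl t) l)))))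
      r-shift : y * poch ([ 2 ] * (t + 1#) + L + 1#) j ≈ r * (y + J)
      r-shift = trans (*-congˡ (sym (poch-cong (solve 2 (λ t L → con (+ 2) :* t :+ L :+ con (+ 1) :+ con (+ 1) :+ con (+ 1)
                                                           := con (+ 2) :* (t :+ con (+ 1)) :+ L :+ con (+ 1)) refl t L) j)))
                      (sym (poch-unfoldˡ _ j))

    Z′≉0 : Z′ ≉ 0#
    Z′≉0 = *-≉0 (*-≉0 (*-≉0 (*-≉0 (poch-≉0 _ l (λ i i<l → 2t+1+i≉0 i (ℕP.<⇒≤ i<l))) (pochStep-odd≉0 l)) (*-≉0 t≉0 t≉0))
                      (poch1≉0 j))
                (poch-≉0 _ j (λ i i<j → 2t+l+2+i≉0 i (ℕP.≤-trans (ℕP.<⇒≤ i<j) j≤l)))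
    Z′d₁≉0 : Z′ * rhs-d₁ t L J ≉ 0#
    Z′d₁≉0 = *-≉0 Z′≉0 (*-≉0 (*-≉0 (*-≉0 (2t+1+i≉0 l ℕP.≤-refl) (-1+2i≉0 l)) (charZero j)) (2t+1+l+1+i≉0 j j≤l))
    Z′d₀≉0 : Z′ * rhs-d₀ t L J ≉ 0#
    Z′d₀≉0 = *-≉0 Z′≉0 (*-≉0 (charZero j) 2t+l+1≉0)
    Z′d₂≉0 : Z′ * rhs-d₂ t L J ≉ 0#
    Z′d₂≉0 = *-≉0 Z′≉0 (*-≉0 (*-≉0 (*-≉0 (*-≉0 (2t+1+i≉0 l ℕP.≤-refl) 2t+1+1+l≉0) (*-≉0 t+1≉0 t+1≉0)) (2t+l+2+i≉0 j j≤l)) 2t+1≉0)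
    K≉0 : K ≉ 0#
    K≉0 = *-≉0 (*-≉0 (*-≉0 t≉0 2t+1≉0) 2t+1≉0) (*-≉0 (*-≉0 2t+1+1≉0 2t+l+2≉0) t≉0)

    shifted-weight : rhsWeight l (t + 1#) j ≈ (Z * rhs-n₂ t L J) / (Z′ * rhs-d₂ t L J)
    shifted-weight = trans (/-scale (*-≉0⁻ˡ (≉0-resp-≈ (sym D₂K) Z′d₂≉0)) K≉0) (*-cong N₂K (⁻¹-cong D₂K))

  shiftedWeight : ℕ → Carrier → ℕ → Carrier
  shiftedWeight l t zero    = 0#
  shiftedWeight l t (suc j) = rhsWeight l (t + 1#) j

  rhsWeight-contiguous : ∀ {l t} → Admissible (suc l) t → ∀ i → i ≤ suc l →
    κ t [ l ] * rhsWeight (suc l) t i ≈ α t [ l ] * rhsWeight l t i + γ t * shiftedWeight l t i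
  rhsWeight-contiguous H zero    _       = rhsWeight-contiguous-zero H
  rhsWeight-contiguous H (suc j) 1+j≤1+l = rhsWeight-contiguous-suc H j (ℕP.≤-pred 1+j≤1+l)

  rhsWeight-beyond : ∀ l t → rhsWeight l t (suc l) ≈ 0#
  rhsWeight-beyond l t = trans (/-congˡ num≈0) (0/y≈0 _)
    where
    -- (-l)_(l + 1) has the factor -l + l.
    num≈0 : rhsNum l t (suc l) ≈ 0#
    num≈0 = trans (*-congʳ (*-congˡ (trans (*-congˡ (-‿inverseˡ [ l ])) (zeroʳ _)))) (trans (*-congʳ (zeroʳ _)) (zeroˡ _))

  rhsSum-contiguous : ∀ {l} n {t} → Admissible (suc l) t →
    κ t [ l ] * rhsSum (suc l) n t ≈ α t [ l ] * rhsSum l n t + γ t * rhsSum l n (t + 1#)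
  rhsSum-contiguous {l} n {t} H = begin
    κ t [ l ] * rhsSum (suc l) n t
      ≈⟨ sumTo-relation (suc l) (λ i i≤1+l → relation-*ʳ (G i) (rhsWeight-contiguous H i i≤1+l)) ⟩
    α t [ l ] * sumTo (suc l) (λ i → rhsWeight l t i * G i) + γ t * sumTo (suc l) (λ i → shiftedWeight l t i * G i)
      ≈⟨ +-cong (*-congˡ unshifted) (*-congˡ shifted) ⟩
    α t [ l ] * rhsSum l n t + γ t * rhsSum l n (t + 1#) ∎
    where
    G : ℕ → Carrier
    G i = closedForm n (t + [ i ])
    unshifted : sumTo (suc l) (λ i → rhsWeight l t i * G i) ≈ rhsSum l n t
    unshifted = trans (+-congˡ (trans (*-congʳ (rhsWeight-beyond l t)) (zeroˡ _))) (+-identityʳ _)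
    shifted : sumTo (suc l) (λ i → shiftedWeight l t i * G i) ≈ rhsSum l n (t + 1#)
    shifted = trans (sumTo-unfoldˡ l _) (trans (+-congʳ (zeroˡ _)) (trans (+-identityˡ _)
                (sumTo-cong l (λ j _ → *-congˡ (closedForm-cong n
                  (solve 2 (λ t J → t :+ (con (+ 1) :+ J) := t :+ con (+ 1) :+ J) refl t [ j ]))))))

  rhsWeight-0-0 : ∀ {t} → t ≉ 0# → rhsWeight 0 t 0 ≈ 1#
  rhsWeight-0-0 {t} t≉0 = trans
    (/-congˡ (solve 1 (λ t → con (+ 1) :* con (+ 1) :* ((t :+ con (+ 0)) :* (t :+ con (+ 0))) :* con (+ 1) :* con (+ 1)
                             := con (+ 1) :* con (+ 1) :* (t :* t) :* con (+ 1) :* con (+ 1)) refl t))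
    (x/x≈1 (*-≉0 (*-≉0 (*-≉0 (*-≉0 1≉0 1≉0) (*-≉0 t≉0 t≉0)) 1≉0) 1≉0))

  lhsSum≈rhsSum : ∀ l n t → Admissible l t → lhsSum l n t ≈ rhsSum l n t
  lhsSum≈rhsSum zero    n t (t≉0 , _) = begin
    lhsSum 0 n t                            ≈⟨ lhsSum≈closedForm n t ⟩
    closedForm n t                          ≈⟨ closedForm-cong n (+-identityʳ t) ⟨
    closedForm n (t + 0#)                   ≈⟨ *-identityˡ _ ⟨
    1# * closedForm n (t + 0#)              ≈⟨ *-congʳ (rhsWeight-0-0 t≉0) ⟨
    rhsSum 0 n t                            ∎
  lhsSum≈rhsSum (suc l) n t H = *-cancelʳ (Factors.κ≉0 H) (begin
    lhsSum (suc l) n t * κ t [ l ]          ≈⟨ *-comm _ _ ⟩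
    κ t [ l ] * lhsSum (suc l) n t          ≈⟨ lhsSum-contiguous l n t ⟩
    α t [ l ] * lhsSum l n t + γ t * lhsSum l n (t + 1#)
      ≈⟨ +-cong (*-congˡ (lhsSum≈rhsSum l n t (admissible-pred H)))
                (*-congˡ (lhsSum≈rhsSum l n (t + 1#) (Factors.shifted H))) ⟩
    α t [ l ] * rhsSum l n t + γ t * rhsSum l n (t + 1#) ≈⟨ rhsSum-contiguous n H ⟨
    κ t [ l ] * rhsSum (suc l) n t          ≈⟨ *-comm _ _ ⟩
    rhsSum (suc l) n t * κ t [ l ]          ∎)

module Normalisation {c ℓ} (F : CharZeroField c ℓ) where
  open RightSide F public

  -- With i standing for k⁻¹, the ring solver can check a ≈ b + c (1 - k i).
  ≈-via-inverse : ∀ {a b c k i} → k * i ≈ 1# → a ≈ b + c * (1# - k * i) → a ≈ b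
  ≈-via-inverse {a} {b} {c} {k} {i} ki≈1 a≈ = begin
    a                        ≈⟨ a≈ ⟩
    b + c * (1# - k * i)     ≈⟨ +-congˡ (*-congˡ (+-congˡ (-‿cong ki≈1))) ⟩
    b + c * (1# - 1#)        ≈⟨ +-congˡ (trans (*-congˡ (-‿inverseʳ 1#)) (zeroʳ c)) ⟩
    b + 0#                   ≈⟨ +-identityʳ b ⟩
    b                        ∎

  [1+k]*[1+k]⁻¹≈1 : ∀ k → [ suc k ] * [ suc k ] ⁻¹ ≈ 1#
  [1+k]*[1+k]⁻¹≈1 k = ⁻¹-inverse _ (charZero k)

  lhs9≈lhsSum : ∀ l n x → lhs9 l n x ≈ lhsSum l n ([ 3 ] * x - 1#)
  lhs9≈lhsSum l n x = sumTo-cong n summand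
    where
    y = [ 3 ] * x
    t = y - 1#
    three-quarters : [ 3 ] / [ 4 ] * [ 2 ] * [ 2 ] ≈ [ 3 ]
    three-quarters = ≈-via-inverse ([1+k]*[1+k]⁻¹≈1 3)
      (solve 1 (λ i → con (+ 3) :* i :* con (+ 2) :* con (+ 2) := con (+ 3) :+ :- con (+ 3) :* (con (+ 1) :- con (+ 4) :* i)) refl _)
    3/2-l≈ : [ 3 ] / [ 2 ] - [ l ] ≈ ([ 3 ] - [ 2 ] * [ l ]) / [ 2 ]
    3/2-l≈ = ≈-via-inverse ([1+k]*[1+k]⁻¹≈1 1)
      (solve 2 (λ L i → con (+ 3) :* i :- L := (con (+ 3) :- con (+ 2) :* L) :* i :+ :- L :* (con (+ 1) :- con (+ 2) :* i)) refl _ _)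
    summand : ∀ k → k ≤ n →
      (poch y k * poch ([ 2 ] - [ l ] - y) k * poch (- [ n ]) k * pow ([ 3 ] / [ 4 ]) k)
        / (poch 1# k * poch ([ 3 ] / [ 2 ] - [ l ]) k * poch (- 1# - [ 3 ] * [ n ]) k)
        ≈ lhsTerm l n t k
    summand k k≤n = /-cross den≉0 (lhsDen≉0 l n k (ℕP.m≤n⇒m≤1+n k≤n)) (begin
      (poch y k * poch ([ 2 ] - [ l ] - y) k * P * w) * (v * f * S * R)
        ≈⟨ *-cong (*-congʳ (*-congʳ (*-cong (poch-cong (solve 1 (λ y → y := y :- con (+ 1) :+ con (+ 1)) refl y) k)
                                            (poch-cong (solve 2 (λ L y → con (+ 2) :- L :- y := con (+ 1) :- L :- (y :- con (+ 1))) refl [ l ] y) k))))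
                  (*-congʳ (*-congˡ S≈)) ⟩
      (A * w) * (v * f * (Pd * v) * R)
        ≈⟨ solve 6 (λ A w v f S R → A :* w :* (v :* f :* (S :* v) :* R) := A :* (w :* v :* v) :* (f :* S :* R)) refl A w v f Pd R ⟩
      (A * (w * v * v)) * (f * Pd * R)
        ≈⟨ *-congʳ (*-congˡ (trans (*-congʳ (pow-*-distrib _ _ k)) (trans (pow-*-distrib _ _ k) (pow-cong three-quarters k)))) ⟩
      (A * pow [ 3 ] k) * (f * Pd * R) ∎)
      where
      P = poch (- [ n ]) k
      w = pow ([ 3 ] / [ 4 ]) k
      v = pow [ 2 ] k
      f = poch 1# k
      S = pochStep [ 2 ] ([ 3 ] - [ 2 ] * [ l ]) k
      R = poch (- 1# - [ 3 ] * [ n ]) k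
      Pd = poch ([ 3 ] / [ 2 ] - [ l ]) k
      A = poch (t + 1#) k * poch (1# - [ l ] - t) k * P
      S≈ : S ≈ Pd * v
      S≈ = sym (trans (*-congʳ (poch-cong 3/2-l≈ k)) (poch-rescale _ _ k [2]≉0))
      den≉0 : f * Pd * R ≉ 0#
      den≉0 = *-≉0 (*-≉0 (poch1≉0 k) (*-≉0⁻ˡ (≉0-resp-≈ S≈ (pochStep-≉0 _ _ k (λ j _ → 3-2l+2j≉0 l j)))))
                   (poch-≉0 _ k (λ j j<k → -1-3n+j≉0 n j (ℕP.≤-trans (ℕP.<⇒≤ j<k) k≤n)))

  admissible : ∀ l x → [ 3 ] * x - 1# ≉ 0# → poch ([ 6 ] * x - 1#) l ≉ 0# →
    (∀ i → i ≤ l → poch ([ 6 ] * x + [ l ] - 1#) i ≉ 0#) → Admissible l ([ 3 ] * x - 1#)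
  admissible l x t≉0 first second = t≉0 , factor≉0
    where
    factor≉0 : ∀ j → j < l ℕ.+ l → [ 2 ] * ([ 3 ] * x - 1#) + [ suc j ] ≉ 0#
    factor≉0 j j<2l with j ℕP.<? l
    ... | yes j<l = ≉0-resp-≈
      (solve 2 (λ x J → con (+ 6) :* x :- con (+ 1) :+ J := con (+ 2) :* (con (+ 3) :* x :- con (+ 1)) :+ (con (+ 1) :+ J)) refl x [ j ])
      (poch-≉0⁻¹ _ l first j j<l)
    ... | no j≮l = ≡.subst (λ m → [ 2 ] * ([ 3 ] * x - 1#) + [ suc m ] ≉ 0#) l+j′≡j (≉0-resp-≈ (begin
        [ 6 ] * x + [ l ] - 1# + [ j′ ]
          ≈⟨ solve 3 (λ x L J → con (+ 6) :* x :+ L :- con (+ 1) :+ J := con (+ 2) :* (con (+ 3) :* x :- con (+ 1)) :+ (con (+ 1) :+ (L :+ J))) refl x [ l ] [ j′ ] ⟩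
        [ 2 ] * ([ 3 ] * x - 1#) + (1# + ([ l ] + [ j′ ]))
          ≈⟨ +-congˡ (+-congˡ ([m+n]≈[m]+[n] l j′)) ⟨
        [ 2 ] * ([ 3 ] * x - 1#) + [ suc (l ℕ.+ j′) ] ∎)
      (poch-≉0⁻¹ _ l (second l ℕP.≤-refl) j′ j′<l))
      where
      j′ = j ℕ.∸ l
      l+j′≡j : l ℕ.+ j′ ≡ j
      l+j′≡j = ℕP.m+[n∸m]≡n (ℕP.≮⇒≥ j≮l)
      j′<l : j′ < l
      j′<l = ℕP.+-cancelˡ-< l j′ l (≡.subst (ℕ._< l ℕ.+ l) (≡.sym l+j′≡j) j<2l)

  rhs9≈rhsSum : ∀ l n x → Admissible l ([ 3 ] * x - 1#) → rhs9 l n x ≈ rhsSum l n ([ 3 ] * x - 1#)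
  rhs9≈rhsSum l n x (t≉0 , h) = trans (*-distribˡ-sumTo l _ _) (sumTo-cong l summand)
    where
    t = [ 3 ] * x - 1#
    2t+1+j≉0 : ∀ j → j < l ℕ.+ l → [ 2 ] * t + 1# + [ j ] ≉ 0#
    2t+1+j≉0 j j<2l = ≉0-resp-≈ (solve 2 (λ t J → con (+ 2) :* t :+ (con (+ 1) :+ J) := con (+ 2) :* t :+ con (+ 1) :+ J) refl t [ j ]) (h j j<2l)
    prefactor : bracket ([ 3 ] * x - 1#) ([ 3 ] * x - 1# / [ 2 ]) ([ 6 ] * x - 1#) (- (1# / [ 2 ])) l
                ≈ (poch t l * pochStep [ 2 ] ([ 2 ] * t + 1#) l) / (poch ([ 2 ] * t + 1#) l * pochStep [ 2 ] (- 1#) l)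
    prefactor = trans
      (*-cong (*-congˡ (poch-cong (≈-via-inverse ([1+k]*[1+k]⁻¹≈1 1)
                 (solve 2 (λ x i → con (+ 3) :* x :- con (+ 1) :* i
                                   := (con (+ 2) :* (con (+ 3) :* x :- con (+ 1)) :+ con (+ 1)) :* i :+ con (+ 3) :* x :* (con (+ 1) :- con (+ 2) :* i)) refl x _)) l))
              (⁻¹-cong (*-cong (poch-cong (solve 1 (λ x → con (+ 6) :* x :- con (+ 1) := con (+ 2) :* (con (+ 3) :* x :- con (+ 1)) :+ con (+ 1)) refl x) l)
                               (poch-cong (solve 1 (λ i → :- (con (+ 1) :* i) := :- con (+ 1) :* i) refl _) l))))
      (poch-ratio-rescale₁ {A = poch t l} {B = poch ([ 2 ] * t + 1#) l} {a = [ 2 ] * t + 1#} {b = - 1#} {k = l}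
        [2]≉0 (*-≉0 (poch-≉0 _ l (λ j j<l → 2t+1+j≉0 j (ℕP.≤-trans j<l (ℕP.m≤m+n l l)))) (pochStep-odd≉0 l)))
    closedForm≈ : ∀ i → bracket (([ 2 ] + [ i ]) / [ 3 ] + x) (([ 4 ] - [ i ]) / [ 3 ] - x) ([ 2 ] / [ 3 ]) ([ 4 ] / [ 3 ]) n
                        ≈ closedForm n (t + [ i ])
    closedForm≈ i = trans
      (*-congʳ (*-cong (poch-cong (≈-via-inverse ([1+k]*[1+k]⁻¹≈1 2)
                          (solve 3 (λ x I i → (con (+ 2) :+ I) :* i :+ x
                                            := (con (+ 3) :* x :- con (+ 1) :+ I :+ con (+ 3)) :* i :+ x :* (con (+ 1) :- con (+ 3) :* i)) refl x [ i ] _)) n)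
                       (poch-cong (≈-via-inverse ([1+k]*[1+k]⁻¹≈1 2)
                          (solve 3 (λ x I i → (con (+ 4) :- I) :* i :- x
                                            := (con (+ 3) :- (con (+ 3) :* x :- con (+ 1) :+ I)) :* i :+ :- x :* (con (+ 1) :- con (+ 3) :* i)) refl x [ i ] _)) n)))
      (poch-ratio-rescale₂ {a₁ = t + [ i ] + [ 3 ]} {a₂ = [ 3 ] - (t + [ i ])} {b₁ = [ 2 ]} {b₂ = [ 4 ]} {k = n}
        (charZero 2) (*-≉0 (pochStep-≉0 _ _ n (λ j _ → 1+a+3j≉0 1 j)) (pochStep-≉0 _ _ n (λ j _ → 1+a+3j≉0 3 j))))
    summand : ∀ i → i ≤ l →
      bracket ([ 3 ] * x - 1#) ([ 3 ] * x - 1# / [ 2 ]) ([ 6 ] * x - 1#) (- (1# / [ 2 ])) l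
        * (pow (([ 3 ] * x + [ i ] - 1#) / ([ 3 ] * x - 1#)) 2
           * bracket (- [ l ]) ([ 6 ] * x - [ 2 ]) 1# ([ 6 ] * x + [ l ] - 1#) i
           * bracket (([ 2 ] + [ i ]) / [ 3 ] + x) (([ 4 ] - [ i ]) / [ 3 ] - x) ([ 2 ] / [ 3 ]) ([ 4 ] / [ 3 ]) n)
        ≈ rhsWeight l t i * closedForm n (t + [ i ])
    summand i i≤l = begin
      _ ≈⟨ *-cong prefactor (*-cong (*-cong square weight) (closedForm≈ i)) ⟩
      (nC / dC) * ((SS / TT) * (P / Q) * closedForm n (t + [ i ]))
        ≈⟨ solve 4 (λ a b c g → a :* (b :* c :* g) := a :* (b :* c) :* g) refl _ _ _ _ ⟩
      (nC / dC) * ((SS / TT) * (P / Q)) * closedForm n (t + [ i ])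
        ≈⟨ *-congʳ (trans (*-congˡ (/-*-/ (*-≉0 t≉0 t≉0) Q≉0)) (/-*-/ dC≉0 (*-≉0 (*-≉0 t≉0 t≉0) Q≉0))) ⟩
      ((nC * (SS * P)) / (dC * (TT * Q))) * closedForm n (t + [ i ])
        ≈⟨ *-congʳ (*-cong (reassociate _ _ _ _ _) (⁻¹-cong (reassociate _ _ _ _ _))) ⟩
      rhsWeight l t i * closedForm n (t + [ i ]) ∎
      where
      nC = poch t l * pochStep [ 2 ] ([ 2 ] * t + 1#) l
      dC = poch ([ 2 ] * t + 1#) l * pochStep [ 2 ] (- 1#) l
      SS = (t + [ i ]) * (t + [ i ])
      TT = t * t
      P = poch (- [ l ]) i * poch ([ 2 ] * t) i
      Q = poch 1# i * poch ([ 2 ] * t + [ l ] + 1#) i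
      reassociate : ∀ a b c d e → a * b * (c * (d * e)) ≈ a * b * c * d * e
      reassociate = solve 5 (λ a b c d e → a :* b :* (c :* (d :* e)) := a :* b :* c :* d :* e) refl
      dC≉0 : dC ≉ 0#
      dC≉0 = *-≉0 (poch-≉0 _ l (λ j j<l → 2t+1+j≉0 j (ℕP.≤-trans j<l (ℕP.m≤m+n l l)))) (pochStep-odd≉0 l)
      Q≉0 : Q ≉ 0#
      Q≉0 = *-≉0 (poch1≉0 i) (poch-≉0 _ i (λ j j<i → ≉0-resp-≈ (begin
              [ 2 ] * t + (1# + [ l ℕ.+ j ])   ≈⟨ +-congˡ (+-congˡ ([m+n]≈[m]+[n] l j)) ⟩
              [ 2 ] * t + (1# + ([ l ] + [ j ])) ≈⟨ solve 3 (λ t L J → con (+ 2) :* t :+ (con (+ 1) :+ (L :+ J))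
                                                      := con (+ 2) :* t :+ L :+ con (+ 1) :+ J) refl t [ l ] [ j ] ⟩
              [ 2 ] * t + [ l ] + 1# + [ j ]   ∎)
            (h (l ℕ.+ j) (ℕP.+-monoʳ-< l (ℕP.<-≤-trans j<i i≤l)))))
      square : pow (([ 3 ] * x + [ i ] - 1#) / ([ 3 ] * x - 1#)) 2 ≈ SS / TT
      square = trans (solve 1 (λ q → con (+ 1) :* q :* q := q :* q) refl _)
        (trans (*-cong ratio ratio) (/-*-/ t≉0 t≉0))
        where
        ratio : ([ 3 ] * x + [ i ] - 1#) / t ≈ (t + [ i ]) / t
        ratio = /-congˡ (solve 2 (λ x I → con (+ 3) :* x :+ I :- con (+ 1) := con (+ 3) :* x :- con (+ 1) :+ I) refl x [ i ])
      weight : bracket (- [ l ]) ([ 6 ] * x - [ 2 ]) 1# ([ 6 ] * x + [ l ] - 1#) i ≈ P / Q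
      weight = *-cong (*-congˡ (poch-cong (solve 1 (λ x → con (+ 6) :* x :- con (+ 2) := con (+ 2) :* (con (+ 3) :* x :- con (+ 1))) refl x) i))
                      (⁻¹-cong (*-congˡ (poch-cong (solve 2 (λ x L → con (+ 6) :* x :+ L :- con (+ 1)
                                                            := con (+ 2) :* (con (+ 3) :* x :- con (+ 1)) :+ L :+ con (+ 1)) refl x [ l ]) i)))

proposition9 : ∀ {c ℓ'} (F : CharZeroField c ℓ') →
  let open CharZeroField F
      open FieldOps F
  in (l n : ℕ) (x : Carrier) →
     ¬ ([ 3 ] * x - 1# ≈ 0#) →
     ¬ (poch ([ 6 ] * x - 1#) l ≈ 0#) →
     (∀ i → i ≤ l → ¬ (poch ([ 6 ] * x + [ l ] - 1#) i ≈ 0#)) →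
     lhs9 l n x ≈ rhs9 l n x
proposition9 F l n x t≉0 first second = begin
  lhs9 l n x                      ≈⟨ lhs9≈lhsSum l n x ⟩
  lhsSum l n ([ 3 ] * x - 1#)     ≈⟨ lhsSum≈rhsSum l n _ admissible′ ⟩
  rhsSum l n ([ 3 ] * x - 1#)     ≈⟨ rhs9≈rhsSum l n x admissible′ ⟨
  rhs9 l n x                      ∎
  where
  open Normalisation F
  admissible′ : Admissible l ([ 3 ] * x - 1#)
  admissible′ = admissible l x t≉0 first second
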